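{- For all integers $n\ge2$, $D\,\mathsf{AExc}_n^{+}(s,t)=D\,\mathsf{AExc}_n^{ - }(s,t)=\tfrac12 D A_n(s,t)$.
   Context: $\mathfrak{S}_n$ is the symmetric group on $[n]$, $\mathcal{A}_n$ its even permutations. $\mathsf{exc}(\pi)=|\{i:\pi_i>i\}|$, $\mathsf{nexc}(\pi)=|\{i:\pi_i\le i\}|$, $\mathsf{des}(\pi)=|\{i\in[n-1]:\pi_i>\pi_{i+1}\}|$, $\mathsf{asc}(\pi)=|\{i\in[n-1]:\pi_i<\pi_{i+1}\}|$. $\mathsf{AExc}_n^{+}(s,t)=\sum_{\pi\in\mathcal{A}_n}t^{\mathsf{exc}(\pi)}s^{\mathsf{nexc}(\pi)-1}$, $\mathsf{AExc}_n^{ - }(s,t)=\sum_{\pi\in\mathfrak{S}_n\setminus\mathcal{A}_n}t^{\mathsf{exc}(\pi)}s^{\mathsf{nexc}(\pi)-1}$, $A_n(s,t)=\sum_{\pi\in\mathfrak{S}_n}t^{\mathsf{des}(\pi)}s^{\mathsf{asc}(\pi)}$, and $D=\frac{\partial}{\partial s}+\frac{\partial}{\partial t}$. -}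

module Defs where

open import Data.Nat using (ℕ; zero; suc; _+_; _*_; _∸_; _<_; _≤_; _<?_; _≤?_)
import Data.Nat as ℕ
open import Data.Nat.Divisibility using (_∣_; _∣?_)
open import Data.Fin using (Fin; toℕ)
import Data.Fin as F
open import Data.Fin.Properties using (all?)
open import Data.List using (List; []; _∷_; [_]; map; concatMap; filter; length; sum; allFin; cartesianProduct; _++_)
open import Data.Product using (_×_; _,_; proj₁; proj₂)
open import Data.Vec.Functional using (Vector) renaming (_∷_ to _∷ᶠ_)
open import Relation.Binary.PropositionalEquality using (_≡_)
open import Relation.Nullary using (Dec; yes; no; ¬_; ¬?)
open import Relation.Nullary.Decidable using (_×-dec_; _→-dec_)

-- Permutations of [n], encoded 0-based: π : Fin n → Fin n injective.
-- (Value toℕ (π i) + 1 at position toℕ i + 1.)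

allFuns : (n k : ℕ) → List (Fin k → Fin n)
allFuns n zero    = [ (λ ()) ]
allFuns n (suc k) = concatMap (λ x → map (λ f → x ∷ᶠ f) (allFuns n k)) (allFin n)

IsPerm : {n : ℕ} → (Fin n → Fin n) → Set
IsPerm {n} π = ∀ i j → π i ≡ π j → i ≡ j

isPerm? : {n : ℕ} (π : Fin n → Fin n) → Dec (IsPerm π)
isPerm? π = all? (λ i → all? (λ j → (π i F.≟ π j) →-dec (i F.≟ j)))

Sym : (n : ℕ) → List (Fin n → Fin n)
Sym n = filter isPerm? (allFuns n n)

count₂ : {n : ℕ} {P : Fin n × Fin n → Set} → ((p : Fin n × Fin n) → Dec (P p)) → ℕ
count₂ {n} P? = length (filter P? (cartesianProduct (allFin n) (allFin n)))

count₁ : {n : ℕ} {P : Fin n → Set} → ((i : Fin n) → Dec (P i)) → ℕ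
count₁ {n} P? = length (filter P? (allFin n))

inv : {n : ℕ} → (Fin n → Fin n) → ℕ
inv π = count₂ (λ p → (toℕ (proj₁ p) <? toℕ (proj₂ p)) ×-dec (toℕ (π (proj₂ p)) <? toℕ (π (proj₁ p))))

IsEven : {n : ℕ} → (Fin n → Fin n) → Set
IsEven π = 2 ∣ inv π

isEven? : {n : ℕ} (π : Fin n → Fin n) → Dec (IsEven π)
isEven? π = 2 ∣? inv π

Alt : (n : ℕ) → List (Fin n → Fin n)
Alt n = filter isEven? (Sym n)

OddPerms : (n : ℕ) → List (Fin n → Fin n)
OddPerms n = filter (λ π → ¬? (isEven? π)) (Sym n)

exc : {n : ℕ} → (Fin n → Fin n) → ℕ
exc π = count₁ (λ i → toℕ i <? toℕ (π i))

nexc : {n : ℕ} → (Fin n → Fin n) → ℕ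
nexc π = count₁ (λ i → toℕ (π i) ≤? toℕ i)

des : {n : ℕ} → (Fin n → Fin n) → ℕ
des π = count₂ (λ p → (suc (toℕ (proj₁ p)) ℕ.≟ toℕ (proj₂ p)) ×-dec (toℕ (π (proj₂ p)) <? toℕ (π (proj₁ p))))

asc : {n : ℕ} → (Fin n → Fin n) → ℕ
asc π = count₂ (λ p → (suc (toℕ (proj₁ p)) ℕ.≟ toℕ (proj₂ p)) ×-dec (toℕ (π (proj₁ p)) <? toℕ (π (proj₂ p))))

-- Polynomials in s, t with ℕ coefficients, as finite lists of monomials.
-- A monomial (c , a , b) stands for c · s^a · t^b.

Mono : Set
Mono = ℕ × ℕ × ℕ

Poly : Set
Poly = List Mono

coeff : Poly → ℕ → ℕ → ℕ
coeff []                  i j = 0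
coeff ((c , a , b) ∷ ms) i j with a ℕ.≟ i | b ℕ.≟ j
... | yes _ | yes _ = c + coeff ms i j
... | _         | _         = coeff ms i j

D : Poly → Poly
D [] = []
D ((c , a , b) ∷ ms) = (c * a , a ∸ 1 , b) ∷ (c * b , a , b ∸ 1) ∷ D ms

genPoly : {n : ℕ} → List (Fin n → Fin n) → ((Fin n → Fin n) → ℕ) → ((Fin n → Fin n) → ℕ) → Poly
genPoly L f g = map (λ π → (1 , f π , g π)) L

-- nexc(π) ≥ 1 always (π_n ≤ n), so nexc π ∸ 1 is the true exponent nexc π - 1
AExc⁺ : ℕ → Poly
AExc⁺ n = genPoly (Alt n) (λ π → nexc π ∸ 1) exc

AExc⁻ : ℕ → Poly
AExc⁻ n = genPoly (OddPerms n) (λ π → nexc π ∸ 1) exc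

Eul : ℕ → Poly
Eul n = genPoly (Sym n) asc des

_≈ₚ_ : Poly → Poly → Set
P ≈ₚ Q = ∀ i j → coeff P i j ≡ coeff Q i j

_·ₚ_ : ℕ → Poly → Poly
k ·ₚ P = map (λ m → (k * proj₁ m , proj₂ m)) P

module Submission where

-- Coefficientwise, D sends Σ_π s^{a π} t^{b π} to Σ_π Dmono i j (a π) (b π).  Since
-- nexc − 1 = n−1−exc and asc = n−1−des, all three sides become sums over 𝔖ₙ of one
-- weight Φ n i j applied to exc (for AExc±, weighted by parity) or to des (for A).
-- Two facts then finish the proof:
--   (1) exc and des are equidistributed on 𝔖ₙ (Euler): decompose 𝔖ₙ₊₁ ≅ 𝔖ₙ × [n+1]
--       by inserting a new minimal letter into the cycles (cycIns, tracks exc) or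
--       into the one-line word (posIns, tracks des); both give the same recursion.
--   (2) the signed counts Δₙ(k) = #{even, exc = k} − #{odd, exc = k} equal
--       (−1)ᵏ·C(n−1,k), since cycIns keeps the sign for a new fixed point and flips
--       it otherwise.  Φ(k) lives on k ∈ {j, j+1} with weights n−1−j and j+1, so the
--       absorption identity (j+1)·C(m,j+1) = (m−j)·C(m,j) makes Σ_even Φ = Σ_odd Φ.

open import Defs
open import Data.Nat using (ℕ; zero; suc; _+_; _*_; _∸_; _<_; _≤_; _<?_; _≤?_; z≤n; s≤s; parity)
import Data.Nat as ℕ
open import Data.Nat.Properties
open import Data.Nat.Divisibility using (_∣?_; divides; ∣-refl; ∣⇒≤; ∣m∣n⇒∣m+n; ∣m+n∣m⇒∣n)
open import Data.Parity.Base using (Parity; 0ℙ; 1ℙ; _⁻¹)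
import Data.Parity.Base as ℙ
import Data.Parity.Properties as ℙP
open import Data.Nat.Combinatorics using (_C_; k>n⇒nCk≡0; nCk+nC[k+1]≡[n+1]C[k+1])
open import Data.Nat.Tactic.RingSolver using (solve-∀)
open import Data.Fin using (Fin; toℕ; punchIn; punchOut)
import Data.Fin as F
import Data.Fin.Properties as FP
open import Data.List using (List; []; _∷_; map; concatMap; filter; length; allFin; tabulate; cartesianProduct; _++_)
open import Data.Product using (_×_; _,_; Σ)
open import Data.Sum using (_⊎_; inj₁; inj₂)
open import Data.Empty using (⊥-elim)
open import Data.Vec.Functional using () renaming (_∷_ to _∷ᶠ_)
open import Relation.Binary.PropositionalEquality using (_≡_; _≢_; refl; sym; trans; cong; cong₂; module ≡-Reasoning)
open import Relation.Nullary using (Dec; yes; no; ¬_; ¬?)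
open import Relation.Nullary.Decidable using (_×-dec_)
open import Data.Integer using (ℤ)
import Data.Integer as Z
import Data.Integer.Properties as ZP
import Data.Integer.Tactic.RingSolver as ZR
open import Algebra.Properties.CommutativeMonoid.Sum +-0-commutativeMonoid
  using (sum-syntax; sum-cong-≗; ∑-distrib-+; sum-replicate-zero)
open import Algebra.Properties.Semiring.Sum +-*-semiring using (*-distribˡ-sum)

ind : ∀ {p} {P : Set p} → Dec P → ℕ
ind (yes _) = 1
ind (no _)  = 0

ind-⇔ : ∀ {p q} {P : Set p} {Q : Set q} (d : Dec P) (e : Dec Q) → (P → Q) → (Q → P) → ind d ≡ ind e
ind-⇔ (yes _) (yes _) f g = refl
ind-⇔ (yes p) (no ¬q) f g = ⊥-elim (¬q (f p))
ind-⇔ (no ¬p) (yes q) f g = ⊥-elim (¬p (g q))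
ind-⇔ (no _)  (no _)  f g = refl

ind-yes : ∀ {p} {P : Set p} (d : Dec P) → P → ind d ≡ 1
ind-yes (yes _) _ = refl
ind-yes (no ¬p) p = ⊥-elim (¬p p)

ind-no : ∀ {p} {P : Set p} (d : Dec P) → ¬ P → ind d ≡ 0
ind-no (yes p) ¬p = ⊥-elim (¬p p)
ind-no (no _)  _  = refl

ind≤1 : ∀ {p} {P : Set p} (d : Dec P) → ind d ≤ 1
ind≤1 (yes _) = s≤s z≤n
ind≤1 (no _)  = z≤n

ind-× : ∀ {p q} {P : Set p} {Q : Set q} (a : Dec P) (b : Dec Q) → ind (a ×-dec b) ≡ ind a * ind b
ind-× (yes _) (yes _) = refl
ind-× (yes _) (no _)  = refl
ind-× (no _)  (yes _) = refl
ind-× (no _)  (no _)  = refl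

ind-<+≤ : ∀ a b → ind (a <? b) + ind (b ≤? a) ≡ 1
ind-<+≤ a b with a <? b | b ≤? a
... | yes p | yes q = ⊥-elim (<⇒≱ p q)
... | yes _ | no _  = refl
... | no _  | yes _ = refl
... | no p  | no q  = ⊥-elim (p (≰⇒> q))

ind-suc< : ∀ a b → ind (suc a <? suc b) ≡ ind (a <? b)
ind-suc< a b = ind-⇔ (suc a <? suc b) (a <? b) ℕ.s<s⁻¹ ℕ.s<s

∑-zero : ∀ {n} (g : Fin n → ℕ) → (∀ i → g i ≡ 0) → ∑[ i < n ] g i ≡ 0
∑-zero {n} g e = trans (sum-cong-≗ {n} e) (sum-replicate-zero n)

∑-ones : ∀ n → ∑[ i < n ] 1 ≡ n
∑-ones zero    = refl
∑-ones (suc n) = cong suc (∑-ones n)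

∑-δ : ∀ {n} (j : Fin n) → ∑[ i < n ] ind (i F.≟ j) ≡ 1
∑-δ {suc n} F.zero    = cong suc (∑-zero {n} _ (λ i → ind-no (F.suc i F.≟ F.zero) (λ ())))
∑-δ {suc n} (F.suc j) = trans (sum-cong-≗ {n} (λ i → ind-⇔ (F.suc i F.≟ F.suc j) (i F.≟ j) FP.suc-injective (cong F.suc))) (∑-δ j)

before : ∀ {n} → (Fin n → ℕ) → Fin n → ℕ
before g F.zero    = 0
before g (F.suc j) = g F.zero + before (λ i → g (F.suc i)) j

after : ∀ {n} → (Fin n → ℕ) → Fin n → ℕ
after {suc n} g F.zero    = ∑[ i < n ] g (F.suc i)
after         g (F.suc j) = after (λ i → g (F.suc i)) j

∑-split : ∀ {n} (g : Fin n → ℕ) j → ∑[ i < n ] g i ≡ before g j + g j + after g j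
∑-split g F.zero    = refl
∑-split g (F.suc j) = trans (cong (g F.zero +_) (∑-split (λ i → g (F.suc i)) j))
                            (reassoc (g F.zero) (before (λ i → g (F.suc i)) j) (g (F.suc j)) (after g (F.suc j)))
  where
  reassoc : ∀ a b c d → a + (b + c + d) ≡ a + b + c + d
  reassoc = solve-∀

before-+ : ∀ {n} (g h : Fin n → ℕ) j → before (λ i → g i + h i) j ≡ before g j + before h j
before-+ g h F.zero    = refl
before-+ g h (F.suc j) = trans (cong (g F.zero + h F.zero +_) (before-+ (λ i → g (F.suc i)) (λ i → h (F.suc i)) j))
                               (shuffle (g F.zero) (h F.zero) (before (λ i → g (F.suc i)) j) (before (λ i → h (F.suc i)) j))
  where
  shuffle : ∀ a b c d → a + b + (c + d) ≡ a + c + (b + d)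
  shuffle = solve-∀

before-ones : ∀ {n} (u : Fin n → ℕ) j → (∀ a → a ≢ j → u a ≡ 1) → before u j ≡ toℕ j
before-ones u F.zero    e = refl
before-ones u (F.suc j) e = cong₂ _+_ (e F.zero (λ ())) (before-ones (λ i → u (F.suc i)) j (λ a ne → e (F.suc a) (λ q → ne (FP.suc-injective q))))

∑-update : ∀ {n} (g h : Fin n → ℕ) (j : Fin n) → (∀ i → i ≢ j → h i ≡ g i) →
           ∑[ i < n ] h i + g j ≡ ∑[ i < n ] g i + h j
∑-update {suc n} g h F.zero e = begin
    h F.zero + ∑[ i < n ] h (F.suc i) + g F.zero
  ≡⟨ cong (λ z → h F.zero + z + g F.zero) (sum-cong-≗ {n} (λ i → e (F.suc i) (λ ()))) ⟩
    h F.zero + ∑[ i < n ] g (F.suc i) + g F.zero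
  ≡⟨ reorder (h F.zero) (∑[ i < n ] g (F.suc i)) (g F.zero) ⟩
    g F.zero + ∑[ i < n ] g (F.suc i) + h F.zero ∎
  where
  open ≡-Reasoning
  reorder : ∀ a b c → a + b + c ≡ c + b + a
  reorder = solve-∀
∑-update {suc n} g h (F.suc j) e = begin
    h F.zero + ∑[ i < n ] h (F.suc i) + g (F.suc j)
  ≡⟨ trans (cong (λ z → z + ∑[ i < n ] h (F.suc i) + g (F.suc j)) (e F.zero (λ ()))) (+-assoc (g F.zero) _ _) ⟩
    g F.zero + (∑[ i < n ] h (F.suc i) + g (F.suc j))
  ≡⟨ cong (g F.zero +_) (∑-update (λ i → g (F.suc i)) (λ i → h (F.suc i)) j (λ i ne → e (F.suc i) (λ q → ne (FP.suc-injective q)))) ⟩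
    g F.zero + (∑[ i < n ] g (F.suc i) + h (F.suc j))
  ≡⟨ sym (+-assoc (g F.zero) _ _) ⟩
    g F.zero + ∑[ i < n ] g (F.suc i) + h (F.suc j) ∎
  where open ≡-Reasoning

∑-bits : ∀ {n} (b : Fin n → ℕ) → (∀ i → b i ≤ 1) → (ψ : ℕ → ℕ) (x : ℕ) →
         ∑[ i < n ] ψ (x + b i) ≡ (n ∸ ∑[ i < n ] b i) * ψ x + ∑[ i < n ] b i * ψ (suc x)
∑-bits {zero}  b bits ψ x = refl
∑-bits {suc n} b bits ψ x = peel (b F.zero) (bits F.zero) (∑-bits b' (λ i → bits (F.suc i)) ψ x) (bounded b' (λ i → bits (F.suc i)))
  where
  b' : Fin n → ℕ
  b' i = b (F.suc i)
  S = ∑[ i < n ] b' i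
  R = ∑[ i < n ] ψ (x + b' i)
  bounded : ∀ {m} (c : Fin m → ℕ) → (∀ i → c i ≤ 1) → ∑[ i < m ] c i ≤ m
  bounded {zero}  c cb = z≤n
  bounded {suc m} c cb = +-mono-≤ (cb F.zero) (bounded (λ i → c (F.suc i)) (λ i → cb (F.suc i)))
  peel : ∀ c → c ≤ 1 → R ≡ (n ∸ S) * ψ x + S * ψ (suc x) → S ≤ n →
         ψ (x + c) + R ≡ (suc n ∸ (c + S)) * ψ x + (c + S) * ψ (suc x)
  peel zero z≤n ih S≤n = begin
      ψ (x + 0) + R
    ≡⟨ cong₂ _+_ (cong ψ (+-identityʳ x)) ih ⟩
      ψ x + ((n ∸ S) * ψ x + S * ψ (suc x))
    ≡⟨ sym (+-assoc (ψ x) _ _) ⟩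
      suc (n ∸ S) * ψ x + S * ψ (suc x)
    ≡⟨ cong (λ z → z * ψ x + S * ψ (suc x)) (sym (+-∸-assoc 1 S≤n)) ⟩
      (suc n ∸ S) * ψ x + S * ψ (suc x) ∎
    where open ≡-Reasoning
  peel (suc zero) (s≤s z≤n) ih S≤n = begin
      ψ (x + 1) + R
    ≡⟨ cong₂ _+_ (cong ψ (+-comm x 1)) ih ⟩
      ψ (suc x) + ((n ∸ S) * ψ x + S * ψ (suc x))
    ≡⟨ swap-front (ψ (suc x)) ((n ∸ S) * ψ x) (S * ψ (suc x)) ⟩
      (n ∸ S) * ψ x + suc S * ψ (suc x) ∎
    where
    open ≡-Reasoning
    swap-front : ∀ a b c → a + (b + c) ≡ b + (a + c)
    swap-front = solve-∀

ΣL : ∀ {a} {A : Set a} → List A → (A → ℕ) → ℕ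
ΣL []       w = 0
ΣL (x ∷ xs) w = w x + ΣL xs w

module _ {a} {A : Set a} where

  ΣL-cong : (xs : List A) {u v : A → ℕ} → (∀ x → u x ≡ v x) → ΣL xs u ≡ ΣL xs v
  ΣL-cong []       e = refl
  ΣL-cong (x ∷ xs) e = cong₂ _+_ (e x) (ΣL-cong xs e)

  ΣL-++ : (xs ys : List A) (w : A → ℕ) → ΣL (xs ++ ys) w ≡ ΣL xs w + ΣL ys w
  ΣL-++ []       ys w = refl
  ΣL-++ (x ∷ xs) ys w = trans (cong (w x +_) (ΣL-++ xs ys w)) (sym (+-assoc (w x) _ _))

  ΣL-+ : (xs : List A) (u v : A → ℕ) → ΣL xs (λ x → u x + v x) ≡ ΣL xs u + ΣL xs v
  ΣL-+ []       u v = refl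
  ΣL-+ (x ∷ xs) u v = trans (cong (u x + v x +_) (ΣL-+ xs u v)) (shuffle (u x) (v x) (ΣL xs u) (ΣL xs v))
    where
    shuffle : ∀ a b c d → a + b + (c + d) ≡ a + c + (b + d)
    shuffle = solve-∀

  ΣL-* : (xs : List A) (k : ℕ) (u : A → ℕ) → ΣL xs (λ x → k * u x) ≡ k * ΣL xs u
  ΣL-* []       k u = sym (*-zeroʳ k)
  ΣL-* (x ∷ xs) k u = trans (cong (k * u x +_) (ΣL-* xs k u)) (sym (*-distribˡ-+ k (u x) _))

  ΣL-0 : (xs : List A) → ΣL xs (λ _ → 0) ≡ 0
  ΣL-0 []       = refl
  ΣL-0 (x ∷ xs) = ΣL-0 xs

  ΣL-filter : ∀ {p} {P : A → Set p} (P? : ∀ x → Dec (P x)) (xs : List A) (w : A → ℕ) →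
              ΣL (filter P? xs) w ≡ ΣL xs (λ x → ind (P? x) * w x)
  ΣL-filter P? []       w = refl
  ΣL-filter P? (x ∷ xs) w with P? x
  ... | yes _ = cong₂ _+_ (sym (+-identityʳ (w x))) (ΣL-filter P? xs w)
  ... | no _  = ΣL-filter P? xs w

  length-filter : ∀ {p} {P : A → Set p} (P? : ∀ x → Dec (P x)) (xs : List A) →
                  length (filter P? xs) ≡ ΣL xs (λ x → ind (P? x))
  length-filter P? []       = refl
  length-filter P? (x ∷ xs) with P? x
  ... | yes _ = cong suc (length-filter P? xs)
  ... | no _  = length-filter P? xs

module _ {a b} {A : Set a} {B : Set b} where

  ΣL-map : (f : A → B) (xs : List A) (w : B → ℕ) → ΣL (map f xs) w ≡ ΣL xs (λ x → w (f x))
  ΣL-map f []       w = refl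
  ΣL-map f (x ∷ xs) w = cong (w (f x) +_) (ΣL-map f xs w)

  ΣL-concatMap : (f : A → List B) (xs : List A) (w : B → ℕ) → ΣL (concatMap f xs) w ≡ ΣL xs (λ x → ΣL (f x) w)
  ΣL-concatMap f []       w = refl
  ΣL-concatMap f (x ∷ xs) w = trans (ΣL-++ (f x) (concatMap f xs) w) (cong (ΣL (f x) w +_) (ΣL-concatMap f xs w))

  ΣL-swap : (xs : List A) (ys : List B) (g : A → B → ℕ) → ΣL xs (λ x → ΣL ys (g x)) ≡ ΣL ys (λ y → ΣL xs (λ x → g x y))
  ΣL-swap []       ys g = sym (ΣL-0 ys)
  ΣL-swap (x ∷ xs) ys g = trans (cong (ΣL ys (g x) +_) (ΣL-swap xs ys g)) (sym (ΣL-+ ys (g x) (λ y → ΣL xs (λ x' → g x' y))))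

ΣL-cartesian : ∀ {a b} {A : Set a} {B : Set b} (xs : List A) (ys : List B) (w : A × B → ℕ) →
               ΣL (cartesianProduct xs ys) w ≡ ΣL xs (λ x → ΣL ys (λ y → w (x , y)))
ΣL-cartesian []       ys w = refl
ΣL-cartesian (x ∷ xs) ys w = trans (ΣL-++ (map (x ,_) ys) _ w) (cong₂ _+_ (ΣL-map (x ,_) ys w) (ΣL-cartesian xs ys w))

ΣL-tabulate : ∀ {a} {A : Set a} {n} (g : Fin n → A) (w : A → ℕ) → ΣL (tabulate g) w ≡ ∑[ i < n ] w (g i)
ΣL-tabulate {n = zero}  g w = refl
ΣL-tabulate {n = suc n} g w = cong (w (g F.zero) +_) (ΣL-tabulate (λ i → g (F.suc i)) w)

ΣL-allFin : ∀ n (w : Fin n → ℕ) → ΣL (allFin n) w ≡ ∑[ i < n ] w i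
ΣL-allFin n w = ΣL-tabulate (λ i → i) w

count₁≡∑ : ∀ {n} {P : Fin n → Set} (P? : ∀ i → Dec (P i)) → count₁ P? ≡ ∑[ i < n ] ind (P? i)
count₁≡∑ {n} P? = trans (length-filter P? (allFin n)) (ΣL-allFin n _)

count₂≡∑ : ∀ {n} {P : Fin n × Fin n → Set} (P? : ∀ p → Dec (P p)) →
           count₂ P? ≡ ∑[ i < n ] ∑[ j < n ] ind (P? (i , j))
count₂≡∑ {n} P? = begin
    count₂ P?
  ≡⟨ length-filter P? (cartesianProduct (allFin n) (allFin n)) ⟩
    ΣL (cartesianProduct (allFin n) (allFin n)) (λ p → ind (P? p))
  ≡⟨ ΣL-cartesian (allFin n) (allFin n) _ ⟩
    ΣL (allFin n) (λ i → ΣL (allFin n) (λ j → ind (P? (i , j))))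
  ≡⟨ ΣL-allFin n _ ⟩
    ∑[ i < n ] ΣL (allFin n) (λ j → ind (P? (i , j)))
  ≡⟨ sum-cong-≗ {n} (λ i → ΣL-allFin n _) ⟩
    ∑[ i < n ] ∑[ j < n ] ind (P? (i , j)) ∎
  where open ≡-Reasoning

-- Exact enumeration of 𝔖ₙ.  Functions are compared pointwise; Sym n lists every
-- permutation exactly once, so sums over it are genuine sums over 𝔖ₙ.

_≈f_ : ∀ {k m} → (Fin k → Fin m) → (Fin k → Fin m) → Set
f ≈f g = ∀ i → f i ≡ g i

_≈?_ : ∀ {k m} (f g : Fin k → Fin m) → Dec (f ≈f g)
f ≈? g = FP.all? (λ i → f i F.≟ g i)

≈-sym : ∀ {k m} {f g : Fin k → Fin m} → f ≈f g → g ≈f f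
≈-sym e i = sym (e i)

≈-trans : ∀ {k m} {f g h : Fin k → Fin m} → f ≈f g → g ≈f h → f ≈f h
≈-trans e e' i = trans (e i) (e' i)

allFuns-exact : ∀ m k (f : Fin k → Fin m) → ΣL (allFuns m k) (λ h → ind (h ≈? f)) ≡ 1
allFuns-exact m zero    f = ind-yes ((λ ()) ≈? f) (λ ())
allFuns-exact m (suc k) f = begin
    ΣL (concatMap (λ x → map (x ∷ᶠ_) (allFuns m k)) (allFin m)) (λ h → ind (h ≈? f))
  ≡⟨ ΣL-concatMap _ (allFin m) _ ⟩
    ΣL (allFin m) (λ x → ΣL (map (x ∷ᶠ_) (allFuns m k)) (λ h → ind (h ≈? f)))
  ≡⟨ ΣL-cong (allFin m) (λ x → trans (ΣL-map _ (allFuns m k) _) (ΣL-cong (allFuns m k) (split x))) ⟩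
    ΣL (allFin m) (λ x → ΣL (allFuns m k) (λ h → ind (x F.≟ f F.zero) * ind (h ≈? tail-f)))
  ≡⟨ ΣL-cong (allFin m) (λ x → ΣL-* (allFuns m k) (ind (x F.≟ f F.zero)) _) ⟩
    ΣL (allFin m) (λ x → ind (x F.≟ f F.zero) * ΣL (allFuns m k) (λ h → ind (h ≈? tail-f)))
  ≡⟨ ΣL-cong (allFin m) (λ x → trans (cong (ind (x F.≟ f F.zero) *_) (allFuns-exact m k tail-f)) (*-identityʳ _)) ⟩
    ΣL (allFin m) (λ x → ind (x F.≟ f F.zero))
  ≡⟨ trans (ΣL-allFin m _) (∑-δ (f F.zero)) ⟩
    1 ∎
  where
  open ≡-Reasoning
  tail-f : Fin k → Fin m
  tail-f = λ i → f (F.suc i)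
  split : ∀ x h → ind ((x ∷ᶠ h) ≈? f) ≡ ind (x F.≟ f F.zero) * ind (h ≈? tail-f)
  split x h = trans (ind-⇔ ((x ∷ᶠ h) ≈? f) ((x F.≟ f F.zero) ×-dec (h ≈? tail-f))
                           (λ e → e F.zero , λ i → e (F.suc i))
                           (λ { (e , e') F.zero → e ; (e , e') (F.suc i) → e' i }))
                    (ind-× (x F.≟ f F.zero) (h ≈? tail-f))

IsPerm-resp : ∀ {m} {f g : Fin m → Fin m} → f ≈f g → IsPerm f → IsPerm g
IsPerm-resp e p i j q = p i j (trans (e i) (trans q (sym (e j))))

ΣL-Sym-cong : ∀ m {u v : (Fin m → Fin m) → ℕ} → (∀ π → IsPerm π → u π ≡ v π) → ΣL (Sym m) u ≡ ΣL (Sym m) v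
ΣL-Sym-cong m {u} {v} e = begin
    ΣL (Sym m) u
  ≡⟨ ΣL-filter isPerm? (allFuns m m) u ⟩
    ΣL (allFuns m m) (λ h → ind (isPerm? h) * u h)
  ≡⟨ ΣL-cong (allFuns m m) pointwise ⟩
    ΣL (allFuns m m) (λ h → ind (isPerm? h) * v h)
  ≡⟨ sym (ΣL-filter isPerm? (allFuns m m) v) ⟩
    ΣL (Sym m) v ∎
  where
  open ≡-Reasoning
  pointwise : ∀ h → ind (isPerm? h) * u h ≡ ind (isPerm? h) * v h
  pointwise h with isPerm? h
  ... | yes p = cong (1 *_) (e h p)
  ... | no _  = refl

Sym-exact : ∀ m (g : Fin m → Fin m) → IsPerm g → ΣL (Sym m) (λ h → ind (h ≈? g)) ≡ 1
Sym-exact m g pg = begin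
    ΣL (Sym m) (λ h → ind (h ≈? g))
  ≡⟨ ΣL-filter isPerm? (allFuns m m) _ ⟩
    ΣL (allFuns m m) (λ h → ind (isPerm? h) * ind (h ≈? g))
  ≡⟨ ΣL-cong (allFuns m m) pointwise ⟩
    ΣL (allFuns m m) (λ h → ind (h ≈? g))
  ≡⟨ allFuns-exact m m g ⟩
    1 ∎
  where
  open ≡-Reasoning
  pointwise : ∀ h → ind (isPerm? h) * ind (h ≈? g) ≡ ind (h ≈? g)
  pointwise h with h ≈? g
  ... | yes e = cong (_* 1) (ind-yes (isPerm? h) (IsPerm-resp (≈-sym e) pg))
  ... | no _  = *-zeroʳ (ind (isPerm? h))

module _ {X : Set} (_≈_ : X → X → Set) (_≈d_ : ∀ x y → Dec (x ≈ y)) (≈-symm : ∀ {x y} → x ≈ y → y ≈ x) where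

  ΣL-transfer : (LA LB : List X) (w : X → ℕ) → (∀ x y → x ≈ y → w x ≡ w y)
    → ΣL LA (λ g → w g * ΣL LB (λ h → ind (h ≈d g))) ≡ ΣL LA w
    → ΣL LB (λ h → w h * ΣL LA (λ g → ind (g ≈d h))) ≡ ΣL LB w
    → ΣL LA w ≡ ΣL LB w
  ΣL-transfer LA LB w w-resp once-in-LB once-in-LA = begin
      ΣL LA w
    ≡⟨ sym once-in-LB ⟩
      ΣL LA (λ g → w g * ΣL LB (λ h → ind (h ≈d g)))
    ≡⟨ ΣL-cong LA (λ g → sym (ΣL-* LB (w g) _)) ⟩
      ΣL LA (λ g → ΣL LB (λ h → w g * ind (h ≈d g)))
    ≡⟨ ΣL-swap LA LB _ ⟩
      ΣL LB (λ h → ΣL LA (λ g → w g * ind (h ≈d g)))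
    ≡⟨ ΣL-cong LB (λ h → ΣL-cong LA (λ g → swap-pair g h)) ⟩
      ΣL LB (λ h → ΣL LA (λ g → w h * ind (g ≈d h)))
    ≡⟨ ΣL-cong LB (λ h → ΣL-* LA (w h) _) ⟩
      ΣL LB (λ h → w h * ΣL LA (λ g → ind (g ≈d h)))
    ≡⟨ once-in-LA ⟩
      ΣL LB w ∎
    where
    open ≡-Reasoning
    swap-pair : ∀ g h → w g * ind (h ≈d g) ≡ w h * ind (g ≈d h)
    swap-pair g h with h ≈d g
    ... | yes e = cong₂ _*_ (w-resp g h (≈-symm e)) (sym (ind-yes (g ≈d h) (≈-symm e)))
    ... | no ne = trans (*-zeroʳ (w g)) (sym (trans (cong (w h *_) (ind-no (g ≈d h) (λ e → ne (≈-symm e)))) (*-zeroʳ (w h))))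

record InsOp (n : ℕ) : Set where
  field
    op      : (Fin n → Fin n) → Fin (suc n) → (Fin (suc n) → Fin (suc n))
    op-perm : ∀ π j → IsPerm π → IsPerm (op π j)
    op-cong : ∀ π π' j → π ≈f π' → op π j ≈f op π' j
    op-inj  : ∀ π π' j j' → op π j ≈f op π' j' → (π ≈f π') × (j ≡ j')
    op-surj : ∀ g → IsPerm g → Σ (Fin n → Fin n) λ π → Σ (Fin (suc n)) λ j → IsPerm π × (op π j ≈f g)

module _ {n : ℕ} (O : InsOp n) where
  open InsOp O

  images : List (Fin (suc n) → Fin (suc n))
  images = concatMap (λ π → map (op π) (allFin (suc n))) (Sym n)

  ΣL-images : ∀ (u : (Fin (suc n) → Fin (suc n)) → ℕ) → ΣL images u ≡ ΣL (Sym n) (λ π → ∑[ j < suc n ] u (op π j))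
  ΣL-images u = trans (ΣL-concatMap _ (Sym n) u)
                      (ΣL-cong (Sym n) (λ π → trans (ΣL-map (op π) (allFin (suc n)) u) (ΣL-allFin (suc n) _)))

  images-exact : ∀ g → IsPerm g → ΣL images (λ h → ind (h ≈? g)) ≡ 1
  images-exact g pg with op-surj g pg
  ... | π₀ , j₀ , p₀ , e₀ = trans (ΣL-images _) (trans (ΣL-cong (Sym n) fibre) (Sym-exact n π₀ p₀))
    where
    hit : ∀ π j → ind (op π j ≈? g) ≡ ind (π ≈? π₀) * ind (j F.≟ j₀)
    hit π j = trans (ind-⇔ (op π j ≈? g) ((π ≈? π₀) ×-dec (j F.≟ j₀))
                           (λ e → op-inj π π₀ j j₀ (≈-trans e (≈-sym e₀)))
                           (λ { (e , refl) → ≈-trans (op-cong π π₀ j e) e₀ }))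
                    (ind-× (π ≈? π₀) (j F.≟ j₀))
    fibre : ∀ π → ∑[ j < suc n ] ind (op π j ≈? g) ≡ ind (π ≈? π₀)
    fibre π = begin
        ∑[ j < suc n ] ind (op π j ≈? g)
      ≡⟨ sum-cong-≗ {suc n} (hit π) ⟩
        ∑[ j < suc n ] (ind (π ≈? π₀) * ind (j F.≟ j₀))
      ≡⟨ sym (*-distribˡ-sum (ind (π ≈? π₀)) (λ j → ind (j F.≟ j₀))) ⟩
        ind (π ≈? π₀) * ∑[ j < suc n ] ind (j F.≟ j₀)
      ≡⟨ cong (ind (π ≈? π₀) *_) (∑-δ j₀) ⟩
        ind (π ≈? π₀) * 1
      ≡⟨ *-identityʳ _ ⟩
        ind (π ≈? π₀) ∎
      where open ≡-Reasoning

  Sym-decompose : (w : (Fin (suc n) → Fin (suc n)) → ℕ) → (∀ x y → x ≈f y → w x ≡ w y)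
                → ΣL (Sym (suc n)) w ≡ ΣL (Sym n) (λ π → ∑[ j < suc n ] w (op π j))
  Sym-decompose w w-resp = trans (ΣL-transfer _≈f_ _≈?_ ≈-sym (Sym (suc n)) images w w-resp once-in-images once-in-Sym)
                                 (ΣL-images w)
    where
    once-in-images : ΣL (Sym (suc n)) (λ g → w g * ΣL images (λ h → ind (h ≈? g))) ≡ ΣL (Sym (suc n)) w
    once-in-images = ΣL-Sym-cong (suc n) (λ g pg → trans (cong (w g *_) (images-exact g pg)) (*-identityʳ _))
    once-in-Sym : ΣL images (λ h → w h * ΣL (Sym (suc n)) (λ g → ind (g ≈? h))) ≡ ΣL images w
    once-in-Sym = trans (ΣL-images _)
                 (trans (ΣL-Sym-cong n (λ π pπ → sum-cong-≗ {suc n} (λ j →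
                           trans (cong (w (op π j) *_) (Sym-exact (suc n) (op π j) (op-perm π j pπ))) (*-identityʳ (w (op π j))))))
                        (sym (ΣL-images w)))

-- Permutations are read as words Fin n → ℕ; the
-- inversion and descent numbers of Defs (double counts over pairs) are rewritten
-- as recursions on the first letter, which is how insertion acts on them.

word : ∀ {n} → (Fin n → Fin n) → (Fin n → ℕ)
word π i = toℕ (π i)

exc-∑ : ∀ {n} (π : Fin n → Fin n) → exc π ≡ ∑[ i < n ] ind (toℕ i <? toℕ (π i))
exc-∑ π = count₁≡∑ (λ i → toℕ i <? toℕ (π i))

exc-cong : ∀ {n} {π π' : Fin n → Fin n} → π ≈f π' → exc π ≡ exc π'
exc-cong {n} {π} {π'} e = trans (exc-∑ π) (trans (sum-cong-≗ {n} (λ i → cong (λ z → ind (toℕ i <? toℕ z)) (e i))) (sym (exc-∑ π')))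

exc+nexc : ∀ {n} (π : Fin n → Fin n) → exc π + nexc π ≡ n
exc+nexc {n} π = begin
    exc π + nexc π
  ≡⟨ cong₂ _+_ (exc-∑ π) (count₁≡∑ (λ i → toℕ (π i) ≤? toℕ i)) ⟩
    ∑[ i < n ] ind (toℕ i <? toℕ (π i)) + ∑[ i < n ] ind (toℕ (π i) ≤? toℕ i)
  ≡⟨ sym (∑-distrib-+ (λ i → ind (toℕ i <? toℕ (π i))) (λ i → ind (toℕ (π i) ≤? toℕ i))) ⟩
    ∑[ i < n ] (ind (toℕ i <? toℕ (π i)) + ind (toℕ (π i) ≤? toℕ i))
  ≡⟨ sum-cong-≗ {n} (λ i → ind-<+≤ (toℕ i) (toℕ (π i))) ⟩
    ∑[ i < n ] 1
  ≡⟨ ∑-ones n ⟩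
    n ∎
  where open ≡-Reasoning

nexc≡n∸exc : ∀ {n} (π : Fin n → Fin n) → nexc π ≡ n ∸ exc π
nexc≡n∸exc {n} π = trans (sym (m+n∸m≡n (exc π) (nexc π))) (cong (_∸ exc π) (exc+nexc π))

invW : ∀ {n} → (Fin n → ℕ) → ℕ
invW {zero}  f = 0
invW {suc n} f = ∑[ i < n ] ind (f (F.suc i) <? f F.zero) + invW (λ i → f (F.suc i))

invW-cong : ∀ {n} {f g : Fin n → ℕ} → (∀ i → f i ≡ g i) → invW f ≡ invW g
invW-cong {zero}  e = refl
invW-cong {suc n} e = cong₂ _+_ (sum-cong-≗ {n} (λ i → cong₂ (λ a b → ind (a <? b)) (e (F.suc i)) (e F.zero)))
                                (invW-cong (λ i → e (F.suc i)))

invW-pairs : ∀ {n} (f : Fin n → ℕ) → ∑[ i < n ] ∑[ j < n ] (ind (toℕ i <? toℕ j) * ind (f j <? f i)) ≡ invW f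
invW-pairs {zero}  f = refl
invW-pairs {suc n} f = cong₂ _+_ first-letter (trans (sum-cong-≗ {n} later) (invW-pairs (λ i → f (F.suc i))))
  where
  first-letter : ∑[ j < suc n ] (ind (0 <? toℕ j) * ind (f j <? f F.zero)) ≡ ∑[ i < n ] ind (f (F.suc i) <? f F.zero)
  first-letter = sum-cong-≗ {n} (λ j → trans (cong (_* ind (f (F.suc j) <? f F.zero)) (ind-yes (0 <? suc (toℕ j)) (s≤s z≤n)))
                                            (+-identityʳ _))
  later : ∀ i → ∑[ j < suc n ] (ind (suc (toℕ i) <? toℕ j) * ind (f j <? f (F.suc i)))
              ≡ ∑[ j < n ] (ind (toℕ i <? toℕ j) * ind (f (F.suc j) <? f (F.suc i)))
  later i = sum-cong-≗ {n} (λ j → cong (_* ind (f (F.suc j) <? f (F.suc i))) (ind-suc< (toℕ i) (toℕ j)))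

inv≡invW : ∀ {n} (π : Fin n → Fin n) → inv π ≡ invW (word π)
inv≡invW {n} π = trans (count₂≡∑ {n} _) (trans (sum-cong-≗ {n} (λ i → sum-cong-≗ {n} (λ j →
                   ind-× (toℕ i <? toℕ j) (toℕ (π j) <? toℕ (π i))))) (invW-pairs (word π)))

adjW : ∀ {n} → (ℕ → ℕ → ℕ) → (Fin n → ℕ) → ℕ
adjW {zero}        r f = 0
adjW {suc zero}    r f = 0
adjW {suc (suc n)} r f = r (f F.zero) (f (F.suc F.zero)) + adjW r (λ i → f (F.suc i))

adjW-cong : ∀ {n} (r : ℕ → ℕ → ℕ) {f g : Fin n → ℕ} → (∀ i → f i ≡ g i) → adjW r f ≡ adjW r g
adjW-cong {zero}        r e = refl
adjW-cong {suc zero}    r e = refl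
adjW-cong {suc (suc n)} r e = cong₂ _+_ (cong₂ r (e F.zero) (e (F.suc F.zero))) (adjW-cong r (λ i → e (F.suc i)))

adjW-pairs : ∀ {n} (r : ℕ → ℕ → ℕ) (f : Fin n → ℕ) →
             ∑[ i < n ] ∑[ j < n ] (ind (suc (toℕ i) ℕ.≟ toℕ j) * r (f i) (f j)) ≡ adjW r f
adjW-pairs {zero}        r f = refl
adjW-pairs {suc zero}    r f = refl
adjW-pairs {suc (suc n)} r f = cong₂ _+_ first-pair (trans (sum-cong-≗ {suc n} later) (adjW-pairs r (λ i → f (F.suc i))))
  where
  first-pair : ∑[ j < suc (suc n) ] (ind (1 ℕ.≟ toℕ j) * r (f F.zero) (f j)) ≡ r (f F.zero) (f (F.suc F.zero))
  first-pair = trans (cong₂ _+_ (*-identityˡ _)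
                             (∑-zero {n} _ (λ j → cong (_* r (f F.zero) (f (F.suc (F.suc j)))) (ind-no (1 ℕ.≟ suc (suc (toℕ j))) (λ ())))))
                     (+-identityʳ _)
  later : ∀ i → ∑[ j < suc (suc n) ] (ind (suc (suc (toℕ i)) ℕ.≟ toℕ j) * r (f (F.suc i)) (f j))
              ≡ ∑[ j < suc n ] (ind (suc (toℕ i) ℕ.≟ toℕ j) * r (f (F.suc i)) (f (F.suc j)))
  later i = sum-cong-≗ {suc n} (λ j → cong (_* r (f (F.suc i)) (f (F.suc j)))
                                          (ind-⇔ (suc (suc (toℕ i)) ℕ.≟ suc (toℕ j)) (suc (toℕ i) ℕ.≟ toℕ j) suc-injective (cong suc)))

rdes : ℕ → ℕ → ℕ
rdes a b = ind (b <? a)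

rasc : ℕ → ℕ → ℕ
rasc a b = ind (a <? b)

desW : ∀ {n} → (Fin n → ℕ) → ℕ
desW = adjW rdes

ascW : ∀ {n} → (Fin n → ℕ) → ℕ
ascW = adjW rasc

des≡desW : ∀ {n} (π : Fin n → Fin n) → des π ≡ desW (word π)
des≡desW {n} π = trans (count₂≡∑ {n} _) (trans (sum-cong-≗ {n} (λ i → sum-cong-≗ {n} (λ j →
                   ind-× (suc (toℕ i) ℕ.≟ toℕ j) (toℕ (π j) <? toℕ (π i))))) (adjW-pairs rdes (word π)))

asc≡ascW : ∀ {n} (π : Fin n → Fin n) → asc π ≡ ascW (word π)
asc≡ascW {n} π = trans (count₂≡∑ {n} _) (trans (sum-cong-≗ {n} (λ i → sum-cong-≗ {n} (λ j →
                   ind-× (suc (toℕ i) ℕ.≟ toℕ j) (toℕ (π i) <? toℕ (π j))))) (adjW-pairs rasc (word π)))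

ascW+desW : ∀ {n} (f : Fin n → ℕ) → (∀ i j → f i ≡ f j → i ≡ j) → ascW f + desW f ≡ n ∸ 1
ascW+desW {zero}        f inj = refl
ascW+desW {suc zero}    f inj = refl
ascW+desW {suc (suc n)} f inj = begin
    rasc a b + ascW f' + (rdes a b + desW f')
  ≡⟨ shuffle (rasc a b) (ascW f') (rdes a b) (desW f') ⟩
    (rasc a b + rdes a b) + (ascW f' + desW f')
  ≡⟨ cong₂ _+_ one-of-two (ascW+desW f' (λ i j e → FP.suc-injective (inj (F.suc i) (F.suc j) e))) ⟩
    suc n ∎
  where
  open ≡-Reasoning
  a = f F.zero
  b = f (F.suc F.zero)
  f' = λ i → f (F.suc i)
  shuffle : ∀ p q r s → p + q + (r + s) ≡ (p + r) + (q + s)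
  shuffle = solve-∀
  one-of-two : rasc a b + rdes a b ≡ 1
  one-of-two with a <? b | b <? a
  ... | yes p | yes q = ⊥-elim (<-asym p q)
  ... | yes _ | no _  = refl
  ... | no _  | yes _ = refl
  ... | no p  | no q with inj F.zero (F.suc F.zero) (≤-antisym (≮⇒≥ q) (≮⇒≥ p))
  ...   | ()

asc≡n∸1∸des : ∀ {n} (π : Fin n → Fin n) → IsPerm π → asc π ≡ (n ∸ 1) ∸ des π
asc≡n∸1∸des {n} π pπ = begin
    asc π
  ≡⟨ trans (asc≡ascW π) (sym (m+n∸n≡m (ascW (word π)) (desW (word π)))) ⟩
    (ascW (word π) + desW (word π)) ∸ desW (word π)
  ≡⟨ cong₂ _∸_ (ascW+desW (word π) (λ i j e → pπ i j (FP.toℕ-injective e))) (sym (des≡desW π)) ⟩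
    (n ∸ 1) ∸ des π ∎
  where open ≡-Reasoning

sgn : ∀ {n} → (Fin n → Fin n) → Parity
sgn π = parity (invW (word π))

sgn-cong : ∀ {n} {π π' : Fin n → Fin n} → π ≈f π' → sgn π ≡ sgn π'
sgn-cong e = cong parity (invW-cong (λ i → cong toℕ (e i)))

evenW : Parity → ℕ
evenW 0ℙ = 1
evenW 1ℙ = 0

oddW : Parity → ℕ
oddW p = evenW (p ⁻¹)

evenW+oddW : ∀ p → evenW p + oddW p ≡ 1
evenW+oddW 0ℙ = refl
evenW+oddW 1ℙ = refl

parity-suc : ∀ x → parity (suc x) ≡ parity x ⁻¹
parity-suc x = trans (sym (ℙP.⁻¹-involutive (parity (suc x)))) (cong _⁻¹ (ℙP.suc-homo-⁻¹ x))

parity-odd-shift : ∀ x L → parity (suc (x + (L + L))) ≡ parity x ⁻¹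
parity-odd-shift x L = begin
    parity (suc (x + (L + L)))
  ≡⟨ parity-suc (x + (L + L)) ⟩
    parity (x + (L + L)) ⁻¹
  ≡⟨ cong _⁻¹ (trans (ℙP.+-homo-+ x (L + L)) (cong (parity x ℙ.+_) (trans (ℙP.+-homo-+ L L) (ℙP.p+p≡0ℙ (parity L))))) ⟩
    (parity x ℙ.+ 0ℙ) ⁻¹
  ≡⟨ cong _⁻¹ (ℙP.+-identityʳ (parity x)) ⟩
    parity x ⁻¹ ∎
  where open ≡-Reasoning

ind-2∣ : ∀ x → ind (2 ∣? x) ≡ evenW (parity x)
ind-2∣ zero          = ind-yes (2 ∣? 0) (divides 0 refl)
ind-2∣ (suc zero)    = ind-no (2 ∣? 1) (λ d → <-irrefl refl (∣⇒≤ d))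
ind-2∣ (suc (suc x)) = trans (ind-⇔ (2 ∣? (2 + x)) (2 ∣? x) (λ d → ∣m+n∣m⇒∣n d ∣-refl) (∣m∣n⇒∣m+n ∣-refl)) (ind-2∣ x)

ind-isEven : ∀ {n} (π : Fin n → Fin n) → ind (isEven? π) ≡ evenW (sgn π)
ind-isEven π = trans (ind-2∣ (inv π)) (cong (λ z → evenW (parity z)) (inv≡invW π))

ind-isOdd : ∀ {n} (π : Fin n → Fin n) → ind (¬? (isEven? π)) ≡ oddW (sgn π)
ind-isOdd π = begin
    ind (¬? (isEven? π))
  ≡⟨ complement (isEven? π) ⟩
    1 ∸ ind (isEven? π)
  ≡⟨ cong (1 ∸_) (ind-isEven π) ⟩
    1 ∸ evenW (sgn π)
  ≡⟨ cong (_∸ evenW (sgn π)) (sym (evenW+oddW (sgn π))) ⟩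
    (evenW (sgn π) + oddW (sgn π)) ∸ evenW (sgn π)
  ≡⟨ m+n∸m≡n (evenW (sgn π)) (oddW (sgn π)) ⟩
    oddW (sgn π) ∎
  where
  open ≡-Reasoning
  complement : ∀ {p} {P : Set p} (d : Dec P) → ind (¬? d) ≡ 1 ∸ ind d
  complement (yes _) = refl
  complement (no _)  = refl

ΣL-Alt : ∀ n (w : (Fin n → Fin n) → ℕ) → ΣL (Alt n) w ≡ ΣL (Sym n) (λ π → evenW (sgn π) * w π)
ΣL-Alt n w = trans (ΣL-filter isEven? (Sym n) w) (ΣL-cong (Sym n) (λ π → cong (_* w π) (ind-isEven π)))

ΣL-Odd : ∀ n (w : (Fin n → Fin n) → ℕ) → ΣL (OddPerms n) w ≡ ΣL (Sym n) (λ π → oddW (sgn π) * w π)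
ΣL-Odd n w = trans (ΣL-filter (λ π → ¬? (isEven? π)) (Sym n) w) (ΣL-cong (Sym n) (λ π → cong (_* w π) (ind-isOdd π)))

-- Letters of Fin (suc n) other than 0 are successors; pred' d recovers the
-- predecessor (the default d is only used at 0).
pred' : ∀ {n} → Fin n → Fin (suc n) → Fin n
pred' d F.zero    = d
pred' d (F.suc y) = y

suc-pred' : ∀ {n} (d : Fin n) (y : Fin (suc n)) → y ≢ F.zero → F.suc (pred' d y) ≡ y
suc-pred' d F.zero    ne = ⊥-elim (ne refl)
suc-pred' d (F.suc y) ne = refl

zero≢suc : ∀ {n} {x : Fin n} → F.zero ≢ F.suc x
zero≢suc ()

hits-zero : ∀ {n} (g : Fin (suc n) → Fin (suc n)) → IsPerm g → Σ (Fin (suc n)) (λ p → g p ≡ F.zero)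
hits-zero {n} g pg with FP.any? (λ p → g p F.≟ F.zero)
... | yes found = found
... | no none with g F.zero in eq
...   | F.zero  = ⊥-elim (none (F.zero , eq))
...   | F.suc v with FP.pigeonhole (n<1+n n) (λ i → pred' v (g i))
...     | i , j , i<j , same = ⊥-elim (<-irrefl (cong toℕ (pg i j (trans (sym (lift i)) (trans (cong F.suc same) (lift j))))) i<j)
  where
  lift : ∀ i → F.suc (pred' v (g i)) ≡ g i
  lift i = suc-pred' v (g i) (λ e → none (i , e))

-- Cycle insertion of a new minimal letter 0 (all old letters shift up by one):
-- cycIns π 0 adds 0 as a fixed point, cycIns π (j+1) inserts 0 into the cycle of
-- π right after j, i.e. j+1 ↦ 0 ↦ π j + 1.

redirect : ∀ {n} {i j : Fin n} → Dec (i ≡ j) → Fin n → Fin (suc n)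
redirect (yes _) v = F.zero
redirect (no _)  v = F.suc v

cycIns : ∀ {n} → (Fin n → Fin n) → Fin (suc n) → (Fin (suc n) → Fin (suc n))
cycIns π F.zero    F.zero    = F.zero
cycIns π F.zero    (F.suc i) = F.suc (π i)
cycIns π (F.suc j) F.zero    = F.suc (π j)
cycIns π (F.suc j) (F.suc i) = redirect (i F.≟ j) (π i)

redirect-yes : ∀ {n} (i j v : Fin n) → i ≡ j → redirect (i F.≟ j) v ≡ F.zero
redirect-yes i j v e with i F.≟ j
... | yes _ = refl
... | no ne = ⊥-elim (ne e)

redirect-no : ∀ {n} (i j v : Fin n) → i ≢ j → redirect (i F.≟ j) v ≡ F.suc v
redirect-no i j v ne with i F.≟ j
... | yes e = ⊥-elim (ne e)
... | no _  = refl

redirect-zero : ∀ {n} (i j v : Fin n) → redirect (i F.≟ j) v ≡ F.zero → i ≡ j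
redirect-zero i j v e with i F.≟ j
... | yes e' = e'
... | no _   = ⊥-elim (zero≢suc (sym e))

cycIns-perm : ∀ {n} (π : Fin n → Fin n) j → IsPerm π → IsPerm (cycIns π j)
cycIns-perm π F.zero p F.zero    F.zero    e = refl
cycIns-perm π F.zero p F.zero    (F.suc b) e = ⊥-elim (zero≢suc e)
cycIns-perm π F.zero p (F.suc a) F.zero    e = ⊥-elim (zero≢suc (sym e))
cycIns-perm π F.zero p (F.suc a) (F.suc b) e = cong F.suc (p a b (FP.suc-injective e))
cycIns-perm π (F.suc j) p F.zero F.zero e = refl
cycIns-perm π (F.suc j) p F.zero (F.suc b) e with b F.≟ j
... | yes _ = ⊥-elim (zero≢suc (sym e))
... | no ne = ⊥-elim (ne (sym (p j b (FP.suc-injective e))))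
cycIns-perm π (F.suc j) p (F.suc a) F.zero e with a F.≟ j
... | yes _ = ⊥-elim (zero≢suc e)
... | no ne = ⊥-elim (ne (p a j (FP.suc-injective e)))
cycIns-perm π (F.suc j) p (F.suc a) (F.suc b) e with a F.≟ j | b F.≟ j
... | yes ea | yes eb = cong F.suc (trans ea (sym eb))
... | yes _  | no _   = ⊥-elim (zero≢suc e)
... | no _   | yes _  = ⊥-elim (zero≢suc (sym e))
... | no _   | no _   = cong F.suc (p a b (FP.suc-injective e))

cycIns-cong : ∀ {n} (π π' : Fin n → Fin n) j → π ≈f π' → cycIns π j ≈f cycIns π' j
cycIns-cong π π' F.zero    e F.zero    = refl
cycIns-cong π π' F.zero    e (F.suc i) = cong F.suc (e i)
cycIns-cong π π' (F.suc j) e F.zero    = cong F.suc (e j)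
cycIns-cong π π' (F.suc j) e (F.suc i) with i F.≟ j
... | yes _ = refl
... | no _  = cong F.suc (e i)

cycIns-inj : ∀ {n} (π π' : Fin n → Fin n) j j' → cycIns π j ≈f cycIns π' j' → (π ≈f π') × (j ≡ j')
cycIns-inj π π' F.zero    F.zero     e = (λ i → FP.suc-injective (e (F.suc i))) , refl
cycIns-inj π π' F.zero    (F.suc j') e = ⊥-elim (zero≢suc (e F.zero))
cycIns-inj π π' (F.suc j) F.zero     e = ⊥-elim (zero≢suc (sym (e F.zero)))
cycIns-inj π π' (F.suc j) (F.suc j') e = same-map , cong F.suc same-j
  where
  -- the preimage of 0 determines j
  same-j : j ≡ j'
  same-j = redirect-zero j j' (π' j) (trans (sym (e (F.suc j))) (redirect-yes j j (π j) refl))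
  same-map : π ≈f π'
  same-map i with i F.≟ j
  ... | yes refl = FP.suc-injective (trans (e F.zero) (cong (λ z → F.suc (π' z)) (sym same-j)))
  ... | no ne    = FP.suc-injective (trans (sym (redirect-no i j (π i) ne))
                                    (trans (e (F.suc i)) (redirect-no i j' (π' i) (λ q → ne (trans q (sym same-j))))))

-- Removing 0 from its cycle inverts cycIns.
cycIns-surj : ∀ {n} (g : Fin (suc n) → Fin (suc n)) → IsPerm g →
              Σ (Fin n → Fin n) λ π → Σ (Fin (suc n)) λ j → IsPerm π × (cycIns π j ≈f g)
cycIns-surj {n} g pg with g F.zero in eq
... | F.zero = π₀ , F.zero , pπ , ok
  where
  g≢0 : ∀ i → g (F.suc i) ≢ F.zero
  g≢0 i e = zero≢suc (sym (pg (F.suc i) F.zero (trans e (sym eq))))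
  π₀ : Fin n → Fin n
  π₀ i = pred' i (g (F.suc i))
  pπ : IsPerm π₀
  pπ a b e = FP.suc-injective (pg (F.suc a) (F.suc b) (trans (sym (suc-pred' a _ (g≢0 a))) (trans (cong F.suc e) (suc-pred' b _ (g≢0 b)))))
  ok : cycIns π₀ F.zero ≈f g
  ok F.zero    = sym eq
  ok (F.suc i) = suc-pred' i _ (g≢0 i)
... | F.suc v with hits-zero g pg
...   | F.zero  , e0 = ⊥-elim (zero≢suc (trans (sym e0) eq))
...   | F.suc j , ej = π₀ , F.suc j , pπ , ok
  where
  π₀ : Fin n → Fin n
  π₀ i = pred' v (g (F.suc i))
  g≢0 : ∀ i → i ≢ j → g (F.suc i) ≢ F.zero
  g≢0 i ne e = ne (FP.suc-injective (pg (F.suc i) (F.suc j) (trans e (sym ej))))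
  π₀j : π₀ j ≡ v
  π₀j = cong (pred' v) ej
  lift : ∀ i → i ≢ j → F.suc (π₀ i) ≡ g (F.suc i)
  lift i ne = suc-pred' v _ (g≢0 i ne)
  pπ : IsPerm π₀
  pπ a b e with a F.≟ j | b F.≟ j
  ... | yes ea   | yes eb = trans ea (sym eb)
  ... | yes refl | no nb  = ⊥-elim (zero≢suc (pg F.zero (F.suc b) (trans eq (trans (cong F.suc (trans (sym π₀j) e)) (lift b nb)))))
  ... | no na    | yes refl = ⊥-elim (zero≢suc (pg F.zero (F.suc a) (trans eq (trans (cong F.suc (trans (sym π₀j) (sym e))) (lift a na)))))
  ... | no na    | no nb  = FP.suc-injective (pg (F.suc a) (F.suc b) (trans (sym (lift a na)) (trans (cong F.suc e) (lift b nb))))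
  ok : cycIns π₀ (F.suc j) ≈f g
  ok F.zero = trans (cong F.suc π₀j) (sym eq)
  ok (F.suc i) with i F.≟ j
  ... | yes refl = sym ej
  ... | no ne    = lift i ne

cycInsOp : ∀ n → InsOp n
cycInsOp n = record { op = cycIns ; op-perm = cycIns-perm ; op-cong = cycIns-cong ; op-inj = cycIns-inj ; op-surj = cycIns-surj }

-- Excedances under cycle insertion: a new fixed point adds none; inserting 0
-- after j creates the excedance 0 ↦ π j + 1 and destroys the one at j, if any,
-- so exc grows exactly when j was a non-excedance.

exc-cycIns-fix : ∀ {n} (π : Fin n → Fin n) → exc (cycIns π F.zero) ≡ exc π
exc-cycIns-fix {n} π = trans (exc-∑ (cycIns π F.zero))
  (trans (sum-cong-≗ {n} (λ i → ind-suc< (toℕ i) (toℕ (π i)))) (sym (exc-∑ π)))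

exc-cycIns-after : ∀ {n} (π : Fin n → Fin n) j → exc (cycIns π (F.suc j)) ≡ exc π + ind (toℕ (π j) ≤? toℕ j)
exc-cycIns-after {n} π j = begin
    exc (cycIns π (F.suc j))
  ≡⟨ exc-∑ (cycIns π (F.suc j)) ⟩
    ind (0 <? suc (toℕ (π j))) + ∑[ i < n ] h i
  ≡⟨ cong (_+ ∑[ i < n ] h i) (trans (ind-yes (0 <? suc (toℕ (π j))) (s≤s z≤n)) (sym (ind-<+≤ (toℕ j) (toℕ (π j))))) ⟩
    g j + nb + ∑[ i < n ] h i
  ≡⟨ reorder (g j) nb (∑[ i < n ] h i) ⟩
    ∑[ i < n ] h i + g j + nb
  ≡⟨ cong (_+ nb) (∑-update g h j off-j) ⟩
    ∑[ i < n ] g i + h j + nb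
  ≡⟨ cong (λ z → ∑[ i < n ] g i + z + nb) at-j ⟩
    ∑[ i < n ] g i + 0 + nb
  ≡⟨ cong₂ _+_ (trans (+-identityʳ _) (sym (exc-∑ π))) refl ⟩
    exc π + nb ∎
  where
  open ≡-Reasoning
  h : Fin n → ℕ
  h i = ind (suc (toℕ i) <? toℕ (redirect (i F.≟ j) (π i)))
  g : Fin n → ℕ
  g i = ind (toℕ i <? toℕ (π i))
  nb = ind (toℕ (π j) ≤? toℕ j)
  reorder : ∀ a b c → a + b + c ≡ c + a + b
  reorder = solve-∀
  off-j : ∀ i → i ≢ j → h i ≡ g i
  off-j i ne = trans (cong (λ z → ind (suc (toℕ i) <? toℕ z)) (redirect-no i j (π i) ne)) (ind-suc< (toℕ i) (toℕ (π i)))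
  at-j : h j ≡ 0
  at-j = trans (cong (λ z → ind (suc (toℕ j) <? toℕ z)) (redirect-yes j j (π j) refl)) (ind-no (suc (toℕ j) <? 0) (λ ()))

-- Inserting 0 after j amounts to moving the letter π j + 1 to the
-- front and writing 0 at position j+1; counting the pairs this affects gives
-- inv = inv π + 1 + 2·#{i < j : π i < π j}, an odd change.

invW-shift : ∀ {n} (f : Fin n → ℕ) → invW (λ i → suc (f i)) ≡ invW f
invW-shift {zero}  f = refl
invW-shift {suc n} f = cong₂ _+_ (sum-cong-≗ {n} (λ i → ind-suc< (f (F.suc i)) (f F.zero))) (invW-shift (λ i → f (F.suc i)))

sgn-cycIns-fix : ∀ {n} (π : Fin n → Fin n) → sgn (cycIns π F.zero) ≡ sgn π
sgn-cycIns-fix {n} π = cong parity (cong₂ _+_ (∑-zero {n} _ (λ i → ind-no (suc (toℕ (π i)) <? 0) (λ ()))) (invW-shift (word π)))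

zeroAt : ∀ {n} → (Fin n → ℕ) → Fin n → (Fin n → ℕ)
zeroAt {suc n} f F.zero    = 0 ∷ᶠ (λ i → suc (f (F.suc i)))
zeroAt {suc n} f (F.suc j) = suc (f F.zero) ∷ᶠ zeroAt (λ i → f (F.suc i)) j

zeroAt-at : ∀ {n} (f : Fin n → ℕ) j → zeroAt f j j ≡ 0
zeroAt-at {suc n} f F.zero    = refl
zeroAt-at {suc n} f (F.suc j) = zeroAt-at (λ i → f (F.suc i)) j

zeroAt-off : ∀ {n} (f : Fin n → ℕ) j i → i ≢ j → zeroAt f j i ≡ suc (f i)
zeroAt-off {suc n} f F.zero    F.zero    ne = ⊥-elim (ne refl)
zeroAt-off {suc n} f F.zero    (F.suc i) ne = refl
zeroAt-off {suc n} f (F.suc j) F.zero    ne = refl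
zeroAt-off {suc n} f (F.suc j) (F.suc i) ne = zeroAt-off (λ i → f (F.suc i)) j i (λ q → ne (cong F.suc q))

-- Lowering the letter at j to 0 loses the inversions (j, b) and turns every
-- pair (a, j) with a < j into an inversion.
invW-zeroAt : ∀ {n} (f : Fin n → ℕ) j →
  invW (zeroAt f j) + after (λ b → ind (f b <? f j)) j + before (λ a → ind (f j <? f a)) j ≡ invW f + toℕ j
invW-zeroAt {suc n} f F.zero = begin
    ∑[ i < n ] ind (suc (f (F.suc i)) <? 0) + invW (λ i → suc (f (F.suc i))) + A + 0
  ≡⟨ cong (λ z → z + A + 0) (cong₂ _+_ (∑-zero {n} _ (λ i → ind-no (suc (f (F.suc i)) <? 0) (λ ()))) (invW-shift (λ i → f (F.suc i)))) ⟩
    invW (λ i → f (F.suc i)) + A + 0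
  ≡⟨ reorder (invW (λ i → f (F.suc i))) A ⟩
    A + invW (λ i → f (F.suc i)) + 0 ∎
  where
  open ≡-Reasoning
  A = ∑[ i < n ] ind (f (F.suc i) <? f F.zero)
  reorder : ∀ a b → 0 + a + b + 0 ≡ b + a + 0
  reorder = solve-∀
invW-zeroAt {suc n} f (F.suc k) = combine (∑[ i < n ] h i) (invW (zeroAt f' k)) A' (g k) B' (∑[ i < n ] g i) (invW f') (toℕ k)
                                          first-letter (invW-zeroAt f' k)
  where
  f' : Fin n → ℕ
  f' i = f (F.suc i)
  h : Fin n → ℕ
  h i = ind (zeroAt f' k i <? suc (f F.zero))
  g : Fin n → ℕ
  g i = ind (f' i <? f F.zero)
  A' = after (λ b → ind (f' b <? f' k)) k
  B' = before (λ a → ind (f' k <? f' a)) k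
  -- the first letter of f now also exceeds the new 0
  first-letter : ∑[ i < n ] h i + g k ≡ ∑[ i < n ] g i + 1
  first-letter = trans (∑-update g h k (λ i ne → trans (cong (λ z → ind (z <? suc (f F.zero))) (zeroAt-off f' k i ne)) (ind-suc< (f' i) (f F.zero))))
                       (cong (∑[ i < n ] g i +_) (trans (cong (λ z → ind (z <? suc (f F.zero))) (zeroAt-at f' k)) (ind-yes (0 <? suc (f F.zero)) (s≤s z≤n))))
  combine : ∀ sh ir a gk b sg iw k → sh + gk ≡ sg + 1 → ir + a + b ≡ iw + k → sh + ir + a + (gk + b) ≡ sg + iw + suc k
  combine sh ir a gk b sg iw k e₁ e₂ = begin
      sh + ir + a + (gk + b)
    ≡⟨ regroup sh ir a gk b ⟩
      (sh + gk) + (ir + a + b)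
    ≡⟨ cong₂ _+_ e₁ e₂ ⟩
      (sg + 1) + (iw + k)
    ≡⟨ regroup' sg iw k ⟩
      sg + iw + suc k ∎
    where
    open ≡-Reasoning
    regroup : ∀ sh ir a gk b → sh + ir + a + (gk + b) ≡ (sh + gk) + (ir + a + b)
    regroup = solve-∀
    regroup' : ∀ sg iw k → (sg + 1) + (iw + k) ≡ sg + iw + suc k
    regroup' = solve-∀

cycIns-tail : ∀ {n} (π : Fin n → Fin n) j i → word (cycIns π (F.suc j)) (F.suc i) ≡ zeroAt (word π) j i
cycIns-tail π j i with i F.≟ j
... | yes refl = sym (zeroAt-at (word π) i)
... | no ne    = sym (zeroAt-off (word π) j i ne)

zeroAt-below : ∀ {n} (f : Fin n → ℕ) j →
  ∑[ i < n ] ind (zeroAt f j i <? suc (f j)) ≡ before (λ i → ind (f i <? f j)) j + after (λ i → ind (f i <? f j)) j + 1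
zeroAt-below {n} f j = +-cancelʳ-≡ (below j) _ _ (begin
    ∑[ i < n ] ind (zeroAt f j i <? suc (f j)) + below j
  ≡⟨ ∑-update below (λ i → ind (zeroAt f j i <? suc (f j))) j
       (λ i ne → trans (cong (λ z → ind (z <? suc (f j))) (zeroAt-off f j i ne)) (ind-suc< (f i) (f j))) ⟩
    ∑[ i < n ] below i + ind (zeroAt f j j <? suc (f j))
  ≡⟨ cong₂ _+_ (∑-split below j) (trans (cong (λ z → ind (z <? suc (f j))) (zeroAt-at f j)) (ind-yes (0 <? suc (f j)) (s≤s z≤n))) ⟩
    before below j + below j + after below j + 1
  ≡⟨ reorder (before below j) (below j) (after below j) ⟩
    before below j + after below j + 1 + below j ∎)
  where
  open ≡-Reasoning
  below : Fin n → ℕ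
  below i = ind (f i <? f j)
  reorder : ∀ a b c → a + b + c + 1 ≡ a + c + 1 + b
  reorder = solve-∀

before-below+above : ∀ {n} (f : Fin n → ℕ) → (∀ a b → f a ≡ f b → a ≡ b) → ∀ j →
  before (λ i → ind (f i <? f j)) j + before (λ i → ind (f j <? f i)) j ≡ toℕ j
before-below+above f inj j = trans (sym (before-+ (λ i → ind (f i <? f j)) (λ i → ind (f j <? f i)) j)) (before-ones _ j trichotomy)
  where
  trichotomy : ∀ a → a ≢ j → ind (f a <? f j) + ind (f j <? f a) ≡ 1
  trichotomy a ne with f a <? f j | f j <? f a
  ... | yes p | yes q = ⊥-elim (<-asym p q)
  ... | yes _ | no _  = refl
  ... | no _  | yes _ = refl
  ... | no p  | no q  = ⊥-elim (ne (inj a j (≤-antisym (≮⇒≥ q) (≮⇒≥ p))))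

invW-cycIns-after : ∀ {n} (π : Fin n → Fin n) → IsPerm π → ∀ j →
                    Σ ℕ (λ L → invW (word (cycIns π (F.suc j))) ≡ suc (invW (word π) + (L + L)))
invW-cycIns-after {n} π pπ j = Lb , +-cancelʳ-≡ Bb _ _ (begin
    invW (word (cycIns π (F.suc j))) + Bb
  ≡⟨ cong (_+ Bb) (cong₂ _+_ (trans (sum-cong-≗ {n} (λ i → cong (λ z → ind (z <? suc (f j))) (cycIns-tail π j i))) (zeroAt-below f j))
                               (invW-cong (cycIns-tail π j))) ⟩
    Lb + La + 1 + invW (zeroAt f j) + Bb
  ≡⟨ regroup Lb La (invW (zeroAt f j)) Bb ⟩
    (invW (zeroAt f j) + La + Bb) + (Lb + 1)
  ≡⟨ cong (_+ (Lb + 1)) (trans (invW-zeroAt f j) (cong (invW f +_) (sym (before-below+above f (λ a b e → pπ a b (FP.toℕ-injective e)) j)))) ⟩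
    (invW f + (Lb + Bb)) + (Lb + 1)
  ≡⟨ regroup' (invW f) Lb Bb ⟩
    suc (invW f + (Lb + Lb)) + Bb ∎)
  where
  open ≡-Reasoning
  f = word π
  Lb = before (λ i → ind (f i <? f j)) j
  La = after (λ i → ind (f i <? f j)) j
  Bb = before (λ i → ind (f j <? f i)) j
  regroup : ∀ lb la ir bb → lb + la + 1 + ir + bb ≡ (ir + la + bb) + (lb + 1)
  regroup = solve-∀
  regroup' : ∀ i lb bb → (i + (lb + bb)) + (lb + 1) ≡ suc (i + (lb + lb)) + bb
  regroup' = solve-∀

-- Inserting 0 into a cycle of length ≥ 1 is composing with a transposition.
sgn-cycIns-after : ∀ {n} (π : Fin n → Fin n) → IsPerm π → ∀ j → sgn (cycIns π (F.suc j)) ≡ sgn π ⁻¹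
sgn-cycIns-after π pπ j with invW-cycIns-after π pπ j
... | L , e = trans (cong parity e) (parity-odd-shift (invW (word π)) L)

insert : ∀ {n} {A : Set} → (Fin n → A) → Fin (suc n) → A → (Fin (suc n) → A)
insert         f F.zero    a = a ∷ᶠ f
insert {suc n} f (F.suc p) a = f F.zero ∷ᶠ insert (λ i → f (F.suc i)) p a

insert-at : ∀ {n} {A : Set} (f : Fin n → A) p a → insert f p a p ≡ a
insert-at         f F.zero    a = refl
insert-at {suc n} f (F.suc p) a = insert-at (λ i → f (F.suc i)) p a

insert-punchIn : ∀ {n} {A : Set} (f : Fin n → A) p a i → insert f p a (punchIn p i) ≡ f i
insert-punchIn         f F.zero    a i         = refl
insert-punchIn {suc n} f (F.suc p) a F.zero    = refl
insert-punchIn {suc n} f (F.suc p) a (F.suc i) = insert-punchIn (λ i → f (F.suc i)) p a i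

insert-cong : ∀ {n} {A : Set} {f g : Fin n → A} → (∀ i → f i ≡ g i) → ∀ p a i → insert f p a i ≡ insert g p a i
insert-cong         e F.zero    a F.zero    = refl
insert-cong         e F.zero    a (F.suc i) = e i
insert-cong {suc n} e (F.suc p) a F.zero    = e F.zero
insert-cong {suc n} e (F.suc p) a (F.suc i) = insert-cong (λ i → e (F.suc i)) p a i

insert-map : ∀ {n} {A B : Set} (h : A → B) (f : Fin n → A) p a i → h (insert f p a i) ≡ insert (λ k → h (f k)) p (h a) i
insert-map         h f F.zero    a F.zero    = refl
insert-map         h f F.zero    a (F.suc i) = refl
insert-map {suc n} h f (F.suc p) a F.zero    = refl
insert-map {suc n} h f (F.suc p) a (F.suc i) = insert-map h (λ k → f (F.suc k)) p a i

at-or-punchIn : ∀ {n} (p i : Fin (suc n)) → (i ≡ p) ⊎ Σ (Fin n) (λ k → i ≡ punchIn p k)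
at-or-punchIn p i with i F.≟ p
... | yes e = inj₁ e
... | no ne = inj₂ (punchOut (λ q → ne (sym q)) , sym (FP.punchIn-punchOut (λ q → ne (sym q))))

posIns : ∀ {n} → (Fin n → Fin n) → Fin (suc n) → (Fin (suc n) → Fin (suc n))
posIns π p = insert (λ i → F.suc (π i)) p F.zero

posIns-at : ∀ {n} (π : Fin n → Fin n) p → posIns π p p ≡ F.zero
posIns-at π p = insert-at (λ i → F.suc (π i)) p F.zero

posIns-punchIn : ∀ {n} (π : Fin n → Fin n) p k → posIns π p (punchIn p k) ≡ F.suc (π k)
posIns-punchIn π p k = insert-punchIn (λ i → F.suc (π i)) p F.zero k

posIns-perm : ∀ {n} (π : Fin n → Fin n) p → IsPerm π → IsPerm (posIns π p)
posIns-perm π p pp a b e with at-or-punchIn p a | at-or-punchIn p b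
... | inj₁ ea            | inj₁ eb             = trans ea (sym eb)
... | inj₁ refl          | inj₂ (k , refl)     = ⊥-elim (zero≢suc (trans (sym (posIns-at π p)) (trans e (posIns-punchIn π p k))))
... | inj₂ (k , refl)    | inj₁ refl           = ⊥-elim (zero≢suc (trans (sym (posIns-at π p)) (trans (sym e) (posIns-punchIn π p k))))
... | inj₂ (k , refl)    | inj₂ (k' , refl)    =
  cong (punchIn p) (pp k k' (FP.suc-injective (trans (sym (posIns-punchIn π p k)) (trans e (posIns-punchIn π p k')))))

posIns-cong : ∀ {n} (π π' : Fin n → Fin n) p → π ≈f π' → posIns π p ≈f posIns π' p
posIns-cong π π' p e = insert-cong (λ i → cong F.suc (e i)) p F.zero

posIns-inj : ∀ {n} (π π' : Fin n → Fin n) p p' → posIns π p ≈f posIns π' p' → (π ≈f π') × (p ≡ p')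
posIns-inj π π' p p' e = same-map , same-p
  where
  -- the position of 0 determines p
  same-p : p ≡ p'
  same-p with at-or-punchIn p' p
  ... | inj₁ q       = q
  ... | inj₂ (k , q) = ⊥-elim (zero≢suc (trans (sym (posIns-at π p)) (trans (e p) (trans (cong (posIns π' p') q) (posIns-punchIn π' p' k)))))
  same-map : π ≈f π'
  same-map k = FP.suc-injective (trans (sym (posIns-punchIn π p k))
                                (trans (e (punchIn p k)) (trans (cong (λ z → posIns π' z (punchIn p k)) (sym same-p)) (posIns-punchIn π' p k))))

-- Deleting the letter 0 inverts posIns.
posIns-surj : ∀ {n} (g : Fin (suc n) → Fin (suc n)) → IsPerm g →
              Σ (Fin n → Fin n) λ π → Σ (Fin (suc n)) λ j → IsPerm π × (posIns π j ≈f g)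
posIns-surj {n} g pg with hits-zero g pg
... | p , ep = π₀ , p , pπ , ok
  where
  g≢0 : ∀ k → g (punchIn p k) ≢ F.zero
  g≢0 k e = FP.punchInᵢ≢i p k (pg (punchIn p k) p (trans e (sym ep)))
  π₀ : Fin n → Fin n
  π₀ k = pred' k (g (punchIn p k))
  pπ : IsPerm π₀
  pπ a b e = FP.punchIn-injective p a b (pg (punchIn p a) (punchIn p b)
               (trans (sym (suc-pred' a _ (g≢0 a))) (trans (cong F.suc e) (suc-pred' b _ (g≢0 b)))))
  ok : posIns π₀ p ≈f g
  ok i with at-or-punchIn p i
  ... | inj₁ refl       = trans (posIns-at π₀ p) (sym ep)
  ... | inj₂ (k , refl) = trans (posIns-punchIn π₀ p k) (suc-pred' k _ (g≢0 k))

posInsOp : ∀ n → InsOp n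
posInsOp n = record { op = posIns ; op-perm = posIns-perm ; op-cong = posIns-cong ; op-inj = posIns-inj ; op-surj = posIns-surj }

-- Descents under position insertion.  Inserting 0 at p creates a new descent
-- exactly when p is at the end or in an ascent slot f(p−1) ≤ f p (gapW f p = 1);
-- there are n − des f such slots.

gapW : ∀ {n} → (Fin n → ℕ) → Fin (suc n) → ℕ
gapW {zero}        f F.zero                = 0
gapW {suc n}       f F.zero                = 0
gapW {suc zero}    f (F.suc F.zero)        = 1
gapW {suc (suc n)} f (F.suc F.zero)        = ind (f F.zero ≤? f (F.suc F.zero))
gapW {suc (suc n)} f (F.suc (F.suc p))     = gapW (λ i → f (F.suc i)) (F.suc p)

gapW≤1 : ∀ {n} (f : Fin n → ℕ) p → gapW f p ≤ 1
gapW≤1 {zero}        f F.zero            = z≤n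
gapW≤1 {suc n}       f F.zero            = z≤n
gapW≤1 {suc zero}    f (F.suc F.zero)    = s≤s z≤n
gapW≤1 {suc (suc n)} f (F.suc F.zero)    = ind≤1 (f F.zero ≤? f (F.suc F.zero))
gapW≤1 {suc (suc n)} f (F.suc (F.suc p)) = gapW≤1 (λ i → f (F.suc i)) (F.suc p)

desW-shift : ∀ {n} (f : Fin n → ℕ) → desW (λ i → suc (f i)) ≡ desW f
desW-shift {zero}        f = refl
desW-shift {suc zero}    f = refl
desW-shift {suc (suc n)} f = cong₂ _+_ (ind-suc< (f (F.suc F.zero)) (f F.zero)) (desW-shift (λ i → f (F.suc i)))

desW-insert : ∀ {n} (f : Fin n → ℕ) p → desW (insert (λ i → suc (f i)) p 0) ≡ desW f + gapW f p
desW-insert {zero}        f F.zero            = refl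
desW-insert {suc n}       f F.zero            = trans (desW-shift f) (sym (+-identityʳ _))
desW-insert {suc zero}    f (F.suc F.zero)    = ind-yes (0 <? suc (f F.zero)) (s≤s z≤n)
desW-insert {suc (suc n)} f (F.suc F.zero)    = begin
    ind (0 <? suc a) + (0 + desW (λ i → suc (f' i)))
  ≡⟨ cong₂ _+_ (ind-yes (0 <? suc a) (s≤s z≤n)) (desW-shift f') ⟩
    1 + desW f'
  ≡⟨ cong (_+ desW f') (sym (ind-<+≤ b a)) ⟩
    ind (b <? a) + ind (a ≤? b) + desW f'
  ≡⟨ swap-last (ind (b <? a)) (ind (a ≤? b)) (desW f') ⟩
    ind (b <? a) + desW f' + ind (a ≤? b) ∎
  where
  open ≡-Reasoning
  a = f F.zero
  b = f (F.suc F.zero)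
  f' = λ i → f (F.suc i)
  swap-last : ∀ x y z → x + y + z ≡ x + z + y
  swap-last = solve-∀
desW-insert {suc (suc n)} f (F.suc (F.suc p)) =
  trans (cong₂ _+_ (ind-suc< (f (F.suc F.zero)) (f F.zero)) (desW-insert (λ i → f (F.suc i)) (F.suc p)))
        (sym (+-assoc (ind (f (F.suc F.zero) <? f F.zero)) _ _))

∑-gapW : ∀ {n} (f : Fin n → ℕ) → ∑[ p < suc n ] gapW f p + desW f ≡ n
∑-gapW {zero}        f = refl
∑-gapW {suc zero}    f = refl
∑-gapW {suc (suc n)} f = begin
    ind (a ≤? b) + S + (ind (b <? a) + desW f')
  ≡⟨ regroup (ind (a ≤? b)) S (ind (b <? a)) (desW f') ⟩
    (ind (b <? a) + ind (a ≤? b)) + (S + desW f')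
  ≡⟨ cong₂ _+_ (ind-<+≤ b a) (∑-gapW f') ⟩
    suc (suc n) ∎
  where
  open ≡-Reasoning
  a = f F.zero
  b = f (F.suc F.zero)
  f' : Fin (suc n) → ℕ
  f' i = f (F.suc i)
  S = ∑[ p < suc n ] gapW f' (F.suc p)
  regroup : ∀ x s y d → x + s + (y + d) ≡ (y + x) + (s + d)
  regroup = solve-∀

∑-des-posIns : ∀ {n} (π : Fin n → Fin n) (φ : ℕ → ℕ) →
  ∑[ p < suc n ] φ (des (posIns π p)) ≡ suc (des π) * φ (des π) + (n ∸ des π) * φ (suc (des π))
∑-des-posIns {n} π φ = begin
    ∑[ p < suc n ] φ (des (posIns π p))
  ≡⟨ sum-cong-≗ {suc n} (λ p → cong φ (trans (des≡desW (posIns π p))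
       (trans (adjW-cong rdes (λ i → insert-map toℕ (λ i → F.suc (π i)) p F.zero i)) (desW-insert f p)))) ⟩
    ∑[ p < suc n ] φ (desW f + gapW f p)
  ≡⟨ ∑-bits (gapW f) (gapW≤1 f) φ (desW f) ⟩
    (suc n ∸ G) * φ (desW f) + G * φ (suc (desW f))
  ≡⟨ cong₂ (λ a b → a * φ (desW f) + b * φ (suc (desW f))) slots-fixed slots-new ⟩
    suc (desW f) * φ (desW f) + (n ∸ desW f) * φ (suc (desW f))
  ≡⟨ cong (λ d → suc d * φ d + (n ∸ d) * φ (suc d)) (sym (des≡desW π)) ⟩
    suc (des π) * φ (des π) + (n ∸ des π) * φ (suc (des π)) ∎
  where
  open ≡-Reasoning
  f = word π
  G = ∑[ p < suc n ] gapW f p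
  slots-fixed : suc n ∸ G ≡ suc (desW f)
  slots-fixed = trans (cong (λ z → suc z ∸ G) (sym (∑-gapW f)))
                      (trans (cong (_∸ G) (sym (+-suc G (desW f)))) (m+n∸m≡n G (suc (desW f))))
  slots-new : G ≡ n ∸ desW f
  slots-new = trans (sym (m+n∸n≡m G (desW f))) (cong (_∸ desW f) (∑-gapW f))

∑-cycIns : ∀ {n} (π : Fin n → Fin n) → IsPerm π → (β : Parity → ℕ) (φ : ℕ → ℕ) →
  ∑[ j < suc n ] (β (sgn (cycIns π j)) * φ (exc (cycIns π j)))
  ≡ β (sgn π) * φ (exc π) + β (sgn π ⁻¹) * (exc π * φ (exc π) + (n ∸ exc π) * φ (suc (exc π)))
∑-cycIns {n} π pπ β φ = cong₂ _+_ (cong₂ (λ s e → β s * φ e) (sgn-cycIns-fix π) (exc-cycIns-fix π)) (begin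
    ∑[ j < n ] (β (sgn (cycIns π (F.suc j))) * φ (exc (cycIns π (F.suc j))))
  ≡⟨ sum-cong-≗ {n} (λ j → cong₂ (λ s e → β s * φ e) (sgn-cycIns-after π pπ j) (exc-cycIns-after π j)) ⟩
    ∑[ j < n ] (β b * φ (e + nb j))
  ≡⟨ sym (*-distribˡ-sum (β b) (λ j → φ (e + nb j))) ⟩
    β b * ∑[ j < n ] φ (e + nb j)
  ≡⟨ cong (β b *_) (∑-bits nb (λ j → ind≤1 (toℕ (π j) ≤? toℕ j)) φ e) ⟩
    β b * ((n ∸ N) * φ e + N * φ (suc e))
  ≡⟨ cong (λ z → β b * z) (cong₂ (λ x y → x * φ e + y * φ (suc e)) n∸N≡e N≡n∸e) ⟩
    β b * (e * φ e + (n ∸ e) * φ (suc e)) ∎)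
  where
  open ≡-Reasoning
  b = sgn π ⁻¹
  e = exc π
  nb : Fin n → ℕ
  nb j = ind (toℕ (π j) ≤? toℕ j)
  N = ∑[ j < n ] nb j
  N≡nexc : N ≡ nexc π
  N≡nexc = sym (count₁≡∑ (λ j → toℕ (π j) ≤? toℕ j))
  N≡n∸e : N ≡ n ∸ e
  N≡n∸e = trans N≡nexc (nexc≡n∸exc π)
  n∸N≡e : n ∸ N ≡ e
  n∸N≡e = trans (cong (_∸ N) (sym (trans (cong (e +_) N≡nexc) (exc+nexc π)))) (m+n∸n≡m e N)

step : ℕ → (ℕ → ℕ) → ℕ → ℕ
step n φ k = suc k * φ k + (n ∸ k) * φ (suc k)

exc~des : ∀ n (φ : ℕ → ℕ) → ΣL (Sym n) (λ π → φ (exc π)) ≡ ΣL (Sym n) (λ π → φ (des π))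
exc~des zero    φ = refl
exc~des (suc n) φ = begin
    ΣL (Sym (suc n)) (λ σ → φ (exc σ))
  ≡⟨ Sym-decompose (cycInsOp n) (λ σ → φ (exc σ)) (λ x y e → cong φ (exc-cong e)) ⟩
    ΣL (Sym n) (λ π → ∑[ j < suc n ] φ (exc (cycIns π j)))
  ≡⟨ ΣL-Sym-cong n exc-step ⟩
    ΣL (Sym n) (λ π → step n φ (exc π))
  ≡⟨ exc~des n (step n φ) ⟩
    ΣL (Sym n) (λ π → step n φ (des π))
  ≡⟨ ΣL-Sym-cong n (λ π pπ → sym (∑-des-posIns π φ)) ⟩
    ΣL (Sym n) (λ π → ∑[ p < suc n ] φ (des (posIns π p)))
  ≡⟨ sym (Sym-decompose (posInsOp n) (λ σ → φ (des σ))
            (λ x y e → cong φ (trans (des≡desW x) (trans (adjW-cong rdes (λ i → cong toℕ (e i))) (sym (des≡desW y)))))) ⟩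
    ΣL (Sym (suc n)) (λ σ → φ (des σ)) ∎
  where
  open ≡-Reasoning
  exc-step : ∀ π → IsPerm π → ∑[ j < suc n ] φ (exc (cycIns π j)) ≡ step n φ (exc π)
  exc-step π pπ = trans (sum-cong-≗ {suc n} (λ j → sym (*-identityˡ (φ (exc (cycIns π j))))))
                 (trans (∑-cycIns π pπ (λ _ → 1) φ) (collect (φ (exc π)) (exc π) ((n ∸ exc π) * φ (suc (exc π)))))
    where
    collect : ∀ a k r → 1 * a + 1 * (k * a + r) ≡ suc k * a + r
    collect = solve-∀

C-absorb : ∀ m k → suc k * (m C suc k) ≡ (m ∸ k) * (m C k)
C-absorb zero    k = trans (*-zeroʳ (suc k)) (cong (_* (0 C k)) (sym (0∸n≡0 k)))
C-absorb (suc m) zero = begin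
    1 * (suc m C 1)
  ≡⟨ cong (1 *_) (sym (nCk+nC[k+1]≡[n+1]C[k+1] m 0)) ⟩
    1 * (1 + (m C 1))
  ≡⟨ *-identityˡ _ ⟩
    suc (m C 1)
  ≡⟨ cong suc (trans (sym (*-identityˡ (m C 1))) (trans (C-absorb m 0) (*-identityʳ m))) ⟩
    suc m
  ≡⟨ sym (*-identityʳ (suc m)) ⟩
    suc m * 1 ∎
  where open ≡-Reasoning
C-absorb (suc m) (suc k) = begin
    suc (suc k) * (suc m C suc (suc k))
  ≡⟨ cong (suc (suc k) *_) (sym (nCk+nC[k+1]≡[n+1]C[k+1] m (suc k))) ⟩
    suc (suc k) * (X + (m C suc (suc k)))
  ≡⟨ *-distribˡ-+ (suc (suc k)) X _ ⟩
    suc (suc k) * X + suc (suc k) * (m C suc (suc k))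
  ≡⟨ cong₂ _+_ refl (C-absorb m (suc k)) ⟩
    (X + suc k * X) + (m ∸ suc k) * X
  ≡⟨ cong (λ q → (X + q) + (m ∸ suc k) * X) (C-absorb m k) ⟩
    (X + (m ∸ k) * (m C k)) + (m ∸ suc k) * X
  ≡⟨ regroup X ((m ∸ k) * (m C k)) ((m ∸ suc k) * X) ⟩
    (m ∸ k) * (m C k) + (X + (m ∸ suc k) * X)
  ≡⟨ cong ((m ∸ k) * (m C k) +_) one-more ⟩
    (m ∸ k) * (m C k) + (m ∸ k) * X
  ≡⟨ sym (*-distribˡ-+ (m ∸ k) (m C k) X) ⟩
    (m ∸ k) * ((m C k) + X)
  ≡⟨ cong ((m ∸ k) *_) (nCk+nC[k+1]≡[n+1]C[k+1] m k) ⟩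
    (suc m ∸ suc k) * (suc m C suc k) ∎
  where
  open ≡-Reasoning
  X = m C suc k
  regroup : ∀ x a b → (x + a) + b ≡ a + (x + b)
  regroup = solve-∀
  -- (1 + (m−k−1))·X = (m−k)·X; if k ≥ m then X = 0
  one-more : X + (m ∸ suc k) * X ≡ (m ∸ k) * X
  one-more with k <? m
  ... | yes k<m = cong (_* X) (sym (+-∸-assoc 1 k<m))
  ... | no k≮m  = trans (cong (λ z → z + (m ∸ suc k) * z) X≡0) (trans (*-zeroʳ (m ∸ suc k)) (sym (trans (cong ((m ∸ k) *_) X≡0) (*-zeroʳ (m ∸ k)))))
    where
    X≡0 : X ≡ 0
    X≡0 = k>n⇒nCk≡0 (s≤s (≮⇒≥ k≮m))

C-absorb′ : ∀ m k → suc k * (m C suc k) + (m C k) ≡ (suc m ∸ k) * (m C k)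
C-absorb′ m k with k ≤? m
... | yes k≤m = trans (cong (_+ (m C k)) (C-absorb m k))
                      (trans (+-comm ((m ∸ k) * (m C k)) (m C k)) (cong (_* (m C k)) (sym (+-∸-assoc 1 k≤m))))
... | no k≰m  = trans (cong₂ (λ p q → suc k * p + q) C₁≡0 C₀≡0)
                      (trans (cong (_+ 0) (*-zeroʳ (suc k))) (sym (trans (cong ((suc m ∸ k) *_) C₀≡0) (*-zeroʳ (suc m ∸ k)))))
  where
  C₀≡0 : m C k ≡ 0
  C₀≡0 = k>n⇒nCk≡0 (≰⇒> k≰m)
  C₁≡0 : m C suc k ≡ 0
  C₁≡0 = k>n⇒nCk≡0 (m<n⇒m<1+n (≰⇒> k≰m))

count : ℕ → (Parity → ℕ) → ℕ → ℕ
count n β k = ΣL (Sym n) (λ π → β (sgn π) * ind (exc π ℕ.≟ k))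

flip : (Parity → ℕ) → (Parity → ℕ)
flip β p = β (p ⁻¹)

shifted : ℕ → ℕ → (ℕ → ℕ) → ℕ
shifted n zero    u = 0
shifted n (suc k) u = (n ∸ k) * u k

ΣL-shifted : ∀ {a} {A : Set a} (xs : List A) n k (u : A → ℕ → ℕ) → ΣL xs (λ x → shifted n k (u x)) ≡ shifted n k (λ k' → ΣL xs (λ x → u x k'))
ΣL-shifted xs n zero    u = ΣL-0 xs
ΣL-shifted xs n (suc k) u = ΣL-* xs (n ∸ k) (λ x → u x k)

δ-subst : ∀ (h : ℕ → ℕ) e k → h e * ind (e ℕ.≟ k) ≡ h k * ind (e ℕ.≟ k)
δ-subst h e k with e ℕ.≟ k
... | yes refl = refl
... | no _     = trans (*-zeroʳ (h e)) (sym (*-zeroʳ (h k)))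

coefficient-k : ∀ b e n k → b * (e * ind (e ℕ.≟ k) + (n ∸ e) * ind (suc e ℕ.≟ k))
                          ≡ k * (b * ind (e ℕ.≟ k)) + shifted n k (λ k' → b * ind (e ℕ.≟ k'))
coefficient-k b e n zero = trans (cong (b *_) (cong₂ _+_ (δ-subst (λ x → x) e 0)
                                  (trans (cong ((n ∸ e) *_) (ind-no (suc e ℕ.≟ 0) (λ ()))) (*-zeroʳ (n ∸ e)))))
                                 (*-zeroʳ b)
coefficient-k b e n (suc k) = begin
    b * (e * x + (n ∸ e) * ind (suc e ℕ.≟ suc k))
  ≡⟨ cong (λ q → b * (e * x + (n ∸ e) * q)) (ind-⇔ (suc e ℕ.≟ suc k) (e ℕ.≟ k) suc-injective (cong suc)) ⟩
    b * (e * x + (n ∸ e) * y)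
  ≡⟨ cong (b *_) (cong₂ _+_ (δ-subst (λ q → q) e (suc k)) (δ-subst (n ∸_) e k)) ⟩
    b * (suc k * x + (n ∸ k) * y)
  ≡⟨ distribute b x y (suc k) (n ∸ k) ⟩
    suc k * (b * x) + (n ∸ k) * (b * y) ∎
  where
  open ≡-Reasoning
  x = ind (e ℕ.≟ suc k)
  y = ind (e ℕ.≟ k)
  distribute : ∀ b x y p q → b * (p * x + q * y) ≡ p * (b * x) + q * (b * y)
  distribute = solve-∀

count-rec : ∀ n (β : Parity → ℕ) k → count (suc n) β k ≡ count n β k + (k * count n (flip β) k + shifted n k (count n (flip β)))
count-rec n β k = begin
    count (suc n) β k
  ≡⟨ Sym-decompose (cycInsOp n) (λ σ → β (sgn σ) * ind (exc σ ℕ.≟ k))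
       (λ x y e → cong₂ (λ s c → β s * ind (c ℕ.≟ k)) (sgn-cong e) (exc-cong e)) ⟩
    ΣL (Sym n) (λ π → ∑[ j < suc n ] (β (sgn (cycIns π j)) * ind (exc (cycIns π j) ℕ.≟ k)))
  ≡⟨ ΣL-Sym-cong n (λ π pπ → trans (∑-cycIns π pπ β (λ e → ind (e ℕ.≟ k)))
                                   (cong (β (sgn π) * ind (exc π ℕ.≟ k) +_) (coefficient-k (flip β (sgn π)) (exc π) n k))) ⟩
    ΣL (Sym n) (λ π → β (sgn π) * ind (exc π ℕ.≟ k) + (k * u π k + shifted n k (u π)))
  ≡⟨ ΣL-+ (Sym n) _ _ ⟩
    count n β k + ΣL (Sym n) (λ π → k * u π k + shifted n k (u π))
  ≡⟨ cong (count n β k +_) (trans (ΣL-+ (Sym n) _ _) (cong₂ _+_ (ΣL-* (Sym n) k _) (ΣL-shifted (Sym n) n k u))) ⟩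
    count n β k + (k * count n (flip β) k + shifted n k (count n (flip β))) ∎
  where
  open ≡-Reasoning
  u : (Fin n → Fin n) → ℕ → ℕ
  u π k' = flip β (sgn π) * ind (exc π ℕ.≟ k')

ι : ℕ → ℤ
ι = Z.+_

Δ : ℕ → ℕ → ℤ
Δ n k = ι (count n evenW k) Z.- ι (count n oddW k)

shiftedℤ : ℕ → ℕ → (ℕ → ℤ) → ℤ
shiftedℤ n zero    u = ι 0
shiftedℤ n (suc k) u = ι (n ∸ k) Z.* u k

shifted-cong : ∀ n k {u v : ℕ → ℕ} → (∀ j → u j ≡ v j) → shifted n k u ≡ shifted n k v
shifted-cong n zero    e = refl
shifted-cong n (suc k) e = cong ((n ∸ k) *_) (e k)

ι-shifted : ∀ n k (u v : ℕ → ℕ) → ι (shifted n k u) Z.- ι (shifted n k v) ≡ shiftedℤ n k (λ j → ι (u j) Z.- ι (v j))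
ι-shifted n zero    u v = refl
ι-shifted n (suc k) u v = trans (cong₂ Z._-_ (ZP.pos-* (n ∸ k) (u k)) (ZP.pos-* (n ∸ k) (v k)))
                                (factor (ι (n ∸ k)) (ι (u k)) (ι (v k)))
  where
  factor : ∀ a x y → a Z.* x Z.- a Z.* y ≡ a Z.* (x Z.- y)
  factor = ZR.solve-∀

ι-step : ∀ a b c d → ι (a + (b * c + d)) ≡ ι a Z.+ (ι b Z.* ι c Z.+ ι d)
ι-step a b c d = trans (ZP.pos-+ a (b * c + d)) (cong (λ z → ι a Z.+ z) (trans (ZP.pos-+ (b * c) d) (cong (λ z → z Z.+ ι d) (ZP.pos-* b c))))

Δ-rec : ∀ n k → Δ (suc n) k ≡ Δ n k Z.- ι k Z.* Δ n k Z.- shiftedℤ n k (Δ n)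
Δ-rec n k = begin
    ι (count (suc n) evenW k) Z.- ι (count (suc n) oddW k)
  ≡⟨ cong₂ (λ a b → ι a Z.- ι b) (count-rec n evenW k)
       (trans (count-rec n oddW k) (cong₂ (λ a b → O + (k * a + b)) (flip-oddW k) (shifted-cong n k flip-oddW))) ⟩
    ι (E + (k * O + shifted n k (count n oddW))) Z.- ι (O + (k * E + shifted n k (count n evenW)))
  ≡⟨ cong₂ Z._-_ (ι-step E k O _) (ι-step O k E _) ⟩
    (ι E Z.+ (ι k Z.* ι O Z.+ ι (shifted n k (count n oddW)))) Z.- (ι O Z.+ (ι k Z.* ι E Z.+ ι (shifted n k (count n evenW))))
  ≡⟨ regroup (ι E) (ι O) (ι k) (ι (shifted n k (count n evenW))) (ι (shifted n k (count n oddW))) ⟩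
    Δ n k Z.- ι k Z.* Δ n k Z.- (ι (shifted n k (count n evenW)) Z.- ι (shifted n k (count n oddW)))
  ≡⟨ cong (λ z → Δ n k Z.- ι k Z.* Δ n k Z.- z) (ι-shifted n k (count n evenW) (count n oddW)) ⟩
    Δ n k Z.- ι k Z.* Δ n k Z.- shiftedℤ n k (Δ n) ∎
  where
  open ≡-Reasoning
  E = count n evenW k
  O = count n oddW k
  flip-oddW : ∀ j → count n (flip oddW) j ≡ count n evenW j
  flip-oddW j = ΣL-cong (Sym n) (λ π → cong (λ p → evenW p * ind (exc π ℕ.≟ j)) (ℙP.⁻¹-involutive (sgn π)))
  regroup : ∀ e o x se so → (e Z.+ (x Z.* o Z.+ so)) Z.- (o Z.+ (x Z.* e Z.+ se)) ≡ (e Z.- o) Z.- x Z.* (e Z.- o) Z.- (se Z.- so)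
  regroup = ZR.solve-∀

alt : ℕ → ℤ
alt zero    = ι 1
alt (suc k) = Z.- alt k

Δ-closed : ∀ m k → Δ (suc m) k ≡ alt k Z.* ι (m C k)
Δ-closed zero zero    = refl
Δ-closed zero (suc k) = begin
    Δ 1 (suc k)
  ≡⟨ Δ-rec 0 (suc k) ⟩
    ι 0 Z.- ι (suc k) Z.* ι 0 Z.- ι (0 ∸ k) Z.* Δ 0 k
  ≡⟨ cong (λ z → ι 0 Z.- ι (suc k) Z.* ι 0 Z.- ι z Z.* Δ 0 k) (0∸n≡0 k) ⟩
    ι 0 Z.- ι (suc k) Z.* ι 0 Z.- ι 0 Z.* Δ 0 k
  ≡⟨ vanish (ι (suc k)) (Δ 0 k) (alt (suc k)) ⟩
    alt (suc k) Z.* ι 0 ∎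
  where
  open ≡-Reasoning
  vanish : ∀ x y s → ι 0 Z.- x Z.* ι 0 Z.- ι 0 Z.* y ≡ s Z.* ι 0
  vanish = ZR.solve-∀
Δ-closed (suc m) zero = trans (Δ-rec (suc m) 0) (cong (λ z → z Z.- ι 0 Z.* z Z.- ι 0) (Δ-closed m 0))
Δ-closed (suc m) (suc k) = begin
    Δ (suc (suc m)) (suc k)
  ≡⟨ Δ-rec (suc m) (suc k) ⟩
    Δ (suc m) (suc k) Z.- ι (suc k) Z.* Δ (suc m) (suc k) Z.- ι (suc m ∸ k) Z.* Δ (suc m) k
  ≡⟨ cong₂ (λ a b → a Z.- ι (suc k) Z.* a Z.- ι (suc m ∸ k) Z.* b) (Δ-closed m (suc k)) (Δ-closed m k) ⟩
    (Z.- s) Z.* c₁ Z.- x Z.* ((Z.- s) Z.* c₁) Z.- a Z.* (s Z.* c₀)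
  ≡⟨ expand s c₁ c₀ x a ⟩
    (Z.- s) Z.* c₁ Z.+ x Z.* s Z.* c₁ Z.- s Z.* (a Z.* c₀)
  ≡⟨ cong (λ q → (Z.- s) Z.* c₁ Z.+ x Z.* s Z.* c₁ Z.- s Z.* q) (sym absorb) ⟩
    (Z.- s) Z.* c₁ Z.+ x Z.* s Z.* c₁ Z.- s Z.* (x Z.* c₁ Z.+ c₀)
  ≡⟨ cancel s c₁ c₀ x ⟩
    (Z.- s) Z.* (c₀ Z.+ c₁)
  ≡⟨ cong ((Z.- s) Z.*_) (trans (sym (ZP.pos-+ (m C k) (m C suc k))) (cong ι (nCk+nC[k+1]≡[n+1]C[k+1] m k))) ⟩
    alt (suc k) Z.* ι (suc m C suc k) ∎
  where
  open ≡-Reasoning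
  s = alt k
  c₁ = ι (m C suc k)
  c₀ = ι (m C k)
  x = ι (suc k)
  a = ι (suc m ∸ k)
  expand : ∀ s c₁ c₀ x a → (Z.- s) Z.* c₁ Z.- x Z.* ((Z.- s) Z.* c₁) Z.- a Z.* (s Z.* c₀)
                         ≡ (Z.- s) Z.* c₁ Z.+ x Z.* s Z.* c₁ Z.- s Z.* (a Z.* c₀)
  expand = ZR.solve-∀
  cancel : ∀ s c₁ c₀ x → (Z.- s) Z.* c₁ Z.+ x Z.* s Z.* c₁ Z.- s Z.* (x Z.* c₁ Z.+ c₀) ≡ (Z.- s) Z.* (c₀ Z.+ c₁)
  cancel = ZR.solve-∀
  absorb : x Z.* c₁ Z.+ c₀ ≡ a Z.* c₀
  absorb = trans (cong (Z._+ c₀) (sym (ZP.pos-* (suc k) (m C suc k))))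
                 (trans (sym (ZP.pos-+ (suc k * (m C suc k)) (m C k))) (trans (cong ι (C-absorb′ m k)) (ZP.pos-* (suc m ∸ k) (m C k))))

-- Coefficient extraction.  Dmono i j a b is the coefficient of sⁱtʲ in
-- D(sᵃtᵇ) = a·s^{a−1}tᵇ + b·sᵃt^{b−1}.

Dmono : ℕ → ℕ → ℕ → ℕ → ℕ
Dmono i j a b = ind (a ∸ 1 ℕ.≟ i) * ind (b ℕ.≟ j) * a + ind (a ℕ.≟ i) * ind (b ∸ 1 ℕ.≟ j) * b

coeff-cons : ∀ c a b ms i j → coeff ((c , a , b) ∷ ms) i j ≡ ind (a ℕ.≟ i) * ind (b ℕ.≟ j) * c + coeff ms i j
coeff-cons c a b ms i j with a ℕ.≟ i | b ℕ.≟ j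
... | yes _ | yes _ = cong (_+ coeff ms i j) (sym (+-identityʳ c))
... | yes _ | no _  = refl
... | no _  | yes _ = refl
... | no _  | no _  = refl

coeff-D-genPoly : ∀ {n} (L : List (Fin n → Fin n)) (f g : (Fin n → Fin n) → ℕ) i j →
                  coeff (D (genPoly L f g)) i j ≡ ΣL L (λ π → Dmono i j (f π) (g π))
coeff-D-genPoly []      f g i j = refl
coeff-D-genPoly (π ∷ L) f g i j = begin
    coeff (D (genPoly (π ∷ L) f g)) i j
  ≡⟨ coeff-cons (1 * f π) (f π ∸ 1) (g π) _ i j ⟩
    x * y * (1 * f π) + coeff ((1 * g π , f π , g π ∸ 1) ∷ D (genPoly L f g)) i j
  ≡⟨ cong (x * y * (1 * f π) +_) (coeff-cons (1 * g π) (f π) (g π ∸ 1) _ i j) ⟩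
    x * y * (1 * f π) + (u * v * (1 * g π) + coeff (D (genPoly L f g)) i j)
  ≡⟨ cong (λ r → x * y * (1 * f π) + (u * v * (1 * g π) + r)) (coeff-D-genPoly L f g i j) ⟩
    x * y * (1 * f π) + (u * v * (1 * g π) + ΣL L (λ π → Dmono i j (f π) (g π)))
  ≡⟨ normalise x y (f π) u v (g π) _ ⟩
    Dmono i j (f π) (g π) + ΣL L (λ π → Dmono i j (f π) (g π)) ∎
  where
  open ≡-Reasoning
  x = ind (f π ∸ 1 ℕ.≟ i)
  y = ind (g π ℕ.≟ j)
  u = ind (f π ℕ.≟ i)
  v = ind (g π ∸ 1 ℕ.≟ j)
  normalise : ∀ x y a u v b r → x * y * (1 * a) + (u * v * (1 * b) + r) ≡ x * y * a + u * v * b + r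
  normalise = solve-∀

coeff-scale : ∀ k (P : Poly) i j → coeff (k ·ₚ P) i j ≡ k * coeff P i j
coeff-scale k []                i j = sym (*-zeroʳ k)
coeff-scale k ((c , a , b) ∷ P) i j = begin
    coeff ((k * c , a , b) ∷ (k ·ₚ P)) i j
  ≡⟨ coeff-cons (k * c) a b _ i j ⟩
    x * y * (k * c) + coeff (k ·ₚ P) i j
  ≡⟨ cong (x * y * (k * c) +_) (coeff-scale k P i j) ⟩
    x * y * (k * c) + k * coeff P i j
  ≡⟨ factor x y k c (coeff P i j) ⟩
    k * (x * y * c + coeff P i j)
  ≡⟨ cong (k *_) (sym (coeff-cons c a b P i j)) ⟩
    k * coeff ((c , a , b) ∷ P) i j ∎
  where
  open ≡-Reasoning
  x = ind (a ℕ.≟ i)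
  y = ind (b ℕ.≟ j)
  factor : ∀ x y k c r → x * y * (k * c) + k * r ≡ k * (x * y * c + r)
  factor = solve-∀

-- Both D AExc and D A have coefficients Σ_π Φ(stat π) with the same weight:
-- Φ n i j k = Dmono i j (n−k−1) k, since nexc−1 = n−1−exc and asc = n−1−des.
Φ : ℕ → ℕ → ℕ → ℕ → ℕ
Φ n i j k = Dmono i j ((n ∸ k) ∸ 1) k

Dmono-AExc : ∀ n i j (π : Fin n → Fin n) → Dmono i j (nexc π ∸ 1) (exc π) ≡ Φ n i j (exc π)
Dmono-AExc n i j π = cong (λ a → Dmono i j (a ∸ 1) (exc π)) (nexc≡n∸exc π)

Dmono-Eul : ∀ n i j (π : Fin n → Fin n) → IsPerm π → Dmono i j (asc π) (des π) ≡ Φ n i j (des π)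
Dmono-Eul n i j π pπ = cong (λ a → Dmono i j a (des π)) (trans (asc≡n∸1∸des π pπ) (∸-swap n 1 (des π)))
  where
  ∸-swap : ∀ n a b → (n ∸ a) ∸ b ≡ (n ∸ b) ∸ a
  ∸-swap n a b = trans (∸-+-assoc n a b) (trans (cong (n ∸_) (+-comm a b)) (sym (∸-+-assoc n b a)))

Φ-support : ∀ m i j k → Φ (suc m) i j k
  ≡ (ind ((m ∸ j) ∸ 1 ℕ.≟ i) * (m ∸ j)) * ind (k ℕ.≟ j) + (ind ((m ∸ j) ∸ 1 ℕ.≟ i) * suc j) * ind (k ℕ.≟ suc j)
Φ-support m i j k = cong₂ _+_ at-j (at-suc-j k)
  where
  a : ℕ → ℕ
  a k = (suc m ∸ k) ∸ 1
  rotate : ∀ x y z → x * y * z ≡ (x * z) * y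
  rotate = solve-∀
  at-j : ind (a k ∸ 1 ℕ.≟ i) * ind (k ℕ.≟ j) * a k ≡ (ind ((m ∸ j) ∸ 1 ℕ.≟ i) * (m ∸ j)) * ind (k ℕ.≟ j)
  at-j = trans (rotate (ind (a k ∸ 1 ℕ.≟ i)) (ind (k ℕ.≟ j)) (a k))
         (trans (δ-subst (λ k → ind (a k ∸ 1 ℕ.≟ i) * a k) k j)
                (cong (λ z → (ind (z ∸ 1 ℕ.≟ i) * z) * ind (k ℕ.≟ j)) (trans (∸-+-assoc (suc m) j 1) (cong (suc m ∸_) (+-comm j 1)))))
  at-suc-j : ∀ k → ind (a k ℕ.≟ i) * ind (k ∸ 1 ℕ.≟ j) * k ≡ (ind ((m ∸ j) ∸ 1 ℕ.≟ i) * suc j) * ind (k ℕ.≟ suc j)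
  at-suc-j zero    = trans (*-zeroʳ (ind (a 0 ℕ.≟ i) * ind (0 ∸ 1 ℕ.≟ j)))
                            (sym (trans (cong (c₂ *_) (ind-no (0 ℕ.≟ suc j) (λ ()))) (*-zeroʳ c₂)))
    where c₂ = ind ((m ∸ j) ∸ 1 ℕ.≟ i) * suc j
  at-suc-j (suc k) = trans (rotate (ind (a (suc k) ℕ.≟ i)) (ind (k ℕ.≟ j)) (suc k))
         (trans (δ-subst (λ k → ind (a (suc k) ℕ.≟ i) * suc k) k j)
                (cong ((ind ((m ∸ j) ∸ 1 ℕ.≟ i) * suc j) *_) (ind-⇔ (k ℕ.≟ j) (suc k ℕ.≟ suc j) (cong suc) suc-injective)))

ΣL-Φ : ∀ m i j (β : Parity → ℕ) → ΣL (Sym (suc m)) (λ π → β (sgn π) * Φ (suc m) i j (exc π))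
     ≡ (ind ((m ∸ j) ∸ 1 ℕ.≟ i) * (m ∸ j)) * count (suc m) β j + (ind ((m ∸ j) ∸ 1 ℕ.≟ i) * suc j) * count (suc m) β (suc j)
ΣL-Φ m i j β = trans (ΣL-cong (Sym (suc m)) split)
                     (trans (ΣL-+ (Sym (suc m)) _ _) (cong₂ _+_ (ΣL-* (Sym (suc m)) c₁ _) (ΣL-* (Sym (suc m)) c₂ _)))
  where
  c₁ = ind ((m ∸ j) ∸ 1 ℕ.≟ i) * (m ∸ j)
  c₂ = ind ((m ∸ j) ∸ 1 ℕ.≟ i) * suc j
  distribute : ∀ b c₁ d₁ c₂ d₂ → b * (c₁ * d₁ + c₂ * d₂) ≡ c₁ * (b * d₁) + c₂ * (b * d₂)
  distribute = solve-∀
  split : ∀ π → β (sgn π) * Φ (suc m) i j (exc π) ≡ c₁ * (β (sgn π) * ind (exc π ℕ.≟ j)) + c₂ * (β (sgn π) * ind (exc π ℕ.≟ suc j))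
  split π = trans (cong (β (sgn π) *_) (Φ-support m i j (exc π)))
                  (distribute (β (sgn π)) c₁ (ind (exc π ℕ.≟ j)) c₂ (ind (exc π ℕ.≟ suc j)))

-- Key balance: even and odd permutations give the same Φ-sum, because
-- c₁·Δ(j) + c₂·Δ(j+1) = I·(−1)ʲ·((m−j)·C(m,j) − (j+1)·C(m,j+1)) = 0.
Φ-balance : ∀ m i j → ΣL (Sym (suc m)) (λ π → evenW (sgn π) * Φ (suc m) i j (exc π))
                    ≡ ΣL (Sym (suc m)) (λ π → oddW (sgn π) * Φ (suc m) i j (exc π))
Φ-balance m i j = trans (ΣL-Φ m i j evenW) (trans (ZP.+-injective (ZP.i-j≡0⇒i≡j _ _ difference)) (sym (ΣL-Φ m i j oddW)))
  where
  I = ind ((m ∸ j) ∸ 1 ℕ.≟ i)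
  c₁ = I * (m ∸ j)
  c₂ = I * suc j
  E₀ = count (suc m) evenW j
  E₁ = count (suc m) evenW (suc j)
  O₀ = count (suc m) oddW j
  O₁ = count (suc m) oddW (suc j)
  ι-lin : ∀ a b c d → ι (a * b + c * d) ≡ ι a Z.* ι b Z.+ ι c Z.* ι d
  ι-lin a b c d = trans (ZP.pos-+ (a * b) (c * d)) (cong₂ Z._+_ (ZP.pos-* a b) (ZP.pos-* c d))
  absorbℤ : ι (suc j) Z.* ι (m C suc j) ≡ ι (m ∸ j) Z.* ι (m C j)
  absorbℤ = trans (sym (ZP.pos-* (suc j) (m C suc j))) (trans (cong ι (C-absorb m j)) (ZP.pos-* (m ∸ j) (m C j)))
  collect : ∀ a b e₀ e₁ o₀ o₁ → (a Z.* e₀ Z.+ b Z.* e₁) Z.- (a Z.* o₀ Z.+ b Z.* o₁) ≡ a Z.* (e₀ Z.- o₀) Z.+ b Z.* (e₁ Z.- o₁)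
  collect = ZR.solve-∀
  factor : ∀ x a s c₀ b c₁ → x Z.* a Z.* (s Z.* c₀) Z.+ x Z.* b Z.* ((Z.- s) Z.* c₁) ≡ x Z.* s Z.* (a Z.* c₀ Z.- b Z.* c₁)
  factor = ZR.solve-∀
  vanish : ∀ x s y → x Z.* s Z.* (y Z.- y) ≡ ι 0
  vanish = ZR.solve-∀
  difference : ι (c₁ * E₀ + c₂ * E₁) Z.- ι (c₁ * O₀ + c₂ * O₁) ≡ ι 0
  difference = begin
      ι (c₁ * E₀ + c₂ * E₁) Z.- ι (c₁ * O₀ + c₂ * O₁)
    ≡⟨ cong₂ Z._-_ (ι-lin c₁ E₀ c₂ E₁) (ι-lin c₁ O₀ c₂ O₁) ⟩
      (ι c₁ Z.* ι E₀ Z.+ ι c₂ Z.* ι E₁) Z.- (ι c₁ Z.* ι O₀ Z.+ ι c₂ Z.* ι O₁)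
    ≡⟨ collect (ι c₁) (ι c₂) (ι E₀) (ι E₁) (ι O₀) (ι O₁) ⟩
      ι c₁ Z.* Δ (suc m) j Z.+ ι c₂ Z.* Δ (suc m) (suc j)
    ≡⟨ cong₂ (λ p q → p Z.* Δ (suc m) j Z.+ q Z.* Δ (suc m) (suc j)) (ZP.pos-* I (m ∸ j)) (ZP.pos-* I (suc j)) ⟩
      ι I Z.* ι (m ∸ j) Z.* Δ (suc m) j Z.+ ι I Z.* ι (suc j) Z.* Δ (suc m) (suc j)
    ≡⟨ cong₂ (λ p q → ι I Z.* ι (m ∸ j) Z.* p Z.+ ι I Z.* ι (suc j) Z.* q) (Δ-closed m j) (Δ-closed m (suc j)) ⟩
      ι I Z.* ι (m ∸ j) Z.* (alt j Z.* ι (m C j)) Z.+ ι I Z.* ι (suc j) Z.* ((Z.- alt j) Z.* ι (m C suc j))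
    ≡⟨ factor (ι I) (ι (m ∸ j)) (alt j) (ι (m C j)) (ι (suc j)) (ι (m C suc j)) ⟩
      ι I Z.* alt j Z.* (ι (m ∸ j) Z.* ι (m C j) Z.- ι (suc j) Z.* ι (m C suc j))
    ≡⟨ cong (λ q → ι I Z.* alt j Z.* (ι (m ∸ j) Z.* ι (m C j) Z.- q)) absorbℤ ⟩
      ι I Z.* alt j Z.* (ι (m ∸ j) Z.* ι (m C j) Z.- ι (m ∸ j) Z.* ι (m C j))
    ≡⟨ vanish (ι I) (alt j) (ι (m ∸ j) Z.* ι (m C j)) ⟩
      ι 0 ∎
    where open ≡-Reasoning

ΣL-parity-split : ∀ n (w : (Fin n → Fin n) → ℕ) →
  ΣL (Sym n) (λ π → evenW (sgn π) * w π) + ΣL (Sym n) (λ π → oddW (sgn π) * w π) ≡ ΣL (Sym n) w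
ΣL-parity-split n w = trans (sym (ΣL-+ (Sym n) _ _)) (ΣL-cong (Sym n) (λ π →
  trans (sym (*-distribʳ-+ (w π) (evenW (sgn π)) (oddW (sgn π)))) (trans (cong (_* w π) (evenW+oddW (sgn π))) (*-identityˡ (w π)))))

coeff-D-AExc⁺ : ∀ n i j → coeff (D (AExc⁺ n)) i j ≡ ΣL (Sym n) (λ π → evenW (sgn π) * Φ n i j (exc π))
coeff-D-AExc⁺ n i j = trans (coeff-D-genPoly (Alt n) (λ π → nexc π ∸ 1) exc i j)
  (trans (ΣL-Alt n _) (ΣL-cong (Sym n) (λ π → cong (evenW (sgn π) *_) (Dmono-AExc n i j π))))

coeff-D-AExc⁻ : ∀ n i j → coeff (D (AExc⁻ n)) i j ≡ ΣL (Sym n) (λ π → oddW (sgn π) * Φ n i j (exc π))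
coeff-D-AExc⁻ n i j = trans (coeff-D-genPoly (OddPerms n) (λ π → nexc π ∸ 1) exc i j)
  (trans (ΣL-Odd n _) (ΣL-cong (Sym n) (λ π → cong (oddW (sgn π) *_) (Dmono-AExc n i j π))))

coeff-D-Eul : ∀ n i j → coeff (D (Eul n)) i j ≡ ΣL (Sym n) (λ π → Φ n i j (des π))
coeff-D-Eul n i j = trans (coeff-D-genPoly (Sym n) asc des i j) (ΣL-Sym-cong n (Dmono-Eul n i j))

lemma16 : (n : ℕ) → 2 ≤ n →
    (D (AExc⁺ n) ≈ₚ D (AExc⁻ n)) × ((2 ·ₚ D (AExc⁺ n)) ≈ₚ D (Eul n))
lemma16 zero    ()
lemma16 (suc m) _ = even≈odd , twice-even≈eulerian
  where
  open ≡-Reasoning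
  n = suc m
  Σeven Σodd : ℕ → ℕ → ℕ
  Σeven i j = ΣL (Sym n) (λ π → evenW (sgn π) * Φ n i j (exc π))
  Σodd  i j = ΣL (Sym n) (λ π → oddW (sgn π) * Φ n i j (exc π))
  even≈odd : D (AExc⁺ n) ≈ₚ D (AExc⁻ n)
  even≈odd i j = trans (coeff-D-AExc⁺ n i j) (trans (Φ-balance m i j) (sym (coeff-D-AExc⁻ n i j)))
  twice-even≈eulerian : (2 ·ₚ D (AExc⁺ n)) ≈ₚ D (Eul n)
  twice-even≈eulerian i j = begin
      coeff (2 ·ₚ D (AExc⁺ n)) i j
    ≡⟨ trans (coeff-scale 2 (D (AExc⁺ n)) i j) (cong (2 *_) (coeff-D-AExc⁺ n i j)) ⟩
      Σeven i j + (Σeven i j + 0)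
    ≡⟨ cong (Σeven i j +_) (trans (+-identityʳ _) (Φ-balance m i j)) ⟩
      Σeven i j + Σodd i j
    ≡⟨ ΣL-parity-split n (λ π → Φ n i j (exc π)) ⟩
      ΣL (Sym n) (λ π → Φ n i j (exc π))
    ≡⟨ exc~des n (Φ n i j) ⟩
      ΣL (Sym n) (λ π → Φ n i j (des π))
    ≡⟨ sym (coeff-D-Eul n i j) ⟩
      coeff (D (Eul n)) i j ∎
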